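{- Let $m\in\mathbb Z$. (i) If $m=N_1(1+(x-1)^3h(x))$ for some $h\in\mathbb Z[x]$ with $5\nmid h(1)$, then there is $F\in\mathbb Z[x]$ with $M_{25}(F)=5^3m$, $F(1)=N_2(F)=5$ and $N_1(F)=5m$. (ii) If $m=N_2(1+(x-1)^3h(x))$ for some $h\in\mathbb Z[x]$ with $5\nmid h(1)$, then there is $F\in\mathbb Z[x]$ with $M_{25}(F)=5^3m$, $F(1)=N_1(F)=5$ and $N_2(F)=5m$.
   Context: $M_{25}(F)=\prod_{z^{25}=1}F(z)$. For $j\ge1$, $\omega_j=e^{2\pi i/5^j}$ and for $G\in\mathbb Z[x]$, $N_j(G)=\prod_{1\le \ell\le 5^j,\ 5\nmid \ell}G(\omega_j^\ell)$. -}

module Defs where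

open import Data.Nat as ℕ using (ℕ; zero; suc)
open import Data.Nat.Divisibility using (_∣?_)
open import Data.Integer using (ℤ; +_; _+_; _*_; -_; _-_)
open import Data.List using (List; []; _∷_; foldr; filter; applyUpTo; map)
open import Data.Vec as Vec using (Vec; []; _∷_; head; init; last; zipWith; replicate; tabulate)
open import Data.Fin using (Fin; toℕ)
open import Data.Bool using (if_then_else_)
open import Relation.Nullary using (¬?; does)

-- Integer polynomials as little-endian coefficient lists: a₀ ∷ a₁ ∷ …

Poly : Set
Poly = List ℤ

_+ₚ_ : Poly → Poly → Poly
[] +ₚ q = q
(a ∷ p) +ₚ [] = a ∷ p
(a ∷ p) +ₚ (b ∷ q) = (a + b) ∷ (p +ₚ q)

scaleₚ : ℤ → Poly → Poly
scaleₚ c = map (c *_)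

_*ₚ_ : Poly → Poly → Poly
[] *ₚ q = []
(a ∷ p) *ₚ q = scaleₚ a q +ₚ (+ 0 ∷ (p *ₚ q))

oneₚ : Poly
oneₚ = + 1 ∷ []

xm1 : Poly
xm1 = - (+ 1) ∷ + 1 ∷ []

evalℤ : Poly → ℤ → ℤ
evalℤ p a = foldr (λ c r → c + a * r) (+ 0) p

-- Arithmetic in ℤ[x]/(Φ), Φ = x^(suc n) + Σ_{i ≤ n} φᵢ xⁱ monic.
-- Residues are coefficient vectors of 1, x, …, x^n.

module Residue {n : ℕ} (φ : Vec ℤ (suc n)) where

  R : Set
  R = Vec ℤ (suc n)

  zeroR : R
  zeroR = replicate _ (+ 0)

  constR : ℤ → R
  constR c = c ∷ replicate _ (+ 0)

  _+R_ : R → R → R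
  _+R_ = zipWith _+_

  scaleR : ℤ → R → R
  scaleR c = Vec.map (c *_)

  -- multiplication by x, using x^(suc n) ≡ - Σ φᵢ xⁱ
  mulX : R → R
  mulX r = (+ 0 ∷ init r) +R scaleR (- last r) φ

  _*R_ : R → R → R
  a *R b = Vec.foldr _ (λ c r → scaleR c a +R mulX r) zeroR b

  powX : ℕ → R
  powX zero = constR (+ 1)
  powX (suc ℓ) = mulX (powX ℓ)

  evalR : Poly → R → R
  evalR p y = foldr (λ c r → constR c +R (y *R r)) zeroR p

  prodConj : List ℕ → Poly → R
  prodConj L G = foldr (λ ℓ r → evalR G (powX ℓ) *R r) (constR (+ 1)) L

  -- When ∏_{ℓ ∈ L} G(ω^ℓ) is an integer (ω a root of Φ, Φ irreducible),
  -- its residue is that constant, so it is the constant coefficient.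
  normOver : List ℕ → Poly → ℤ
  normOver L G = head (prodConj L G)

-- Cyclotomic polynomials Φ₅ = 1+x+x²+x³+x⁴ (degree 4),
-- Φ₂₅ = 1+x⁵+x¹⁰+x¹⁵+x²⁰ (degree 20); lower coefficients.

Φ₅-low : Vec ℤ 4
Φ₅-low = tabulate (λ _ → + 1)

Φ₂₅-low : Vec ℤ 20
Φ₂₅-low = tabulate (λ (i : Fin 20) → if does (5 ∣? toℕ i) then + 1 else + 0)

units : ℕ → List ℕ
units N = filter (λ ℓ → ¬? (5 ∣? ℓ)) (applyUpTo suc N)

-- N₁(G) = ∏_{1≤ℓ≤5, 5∤ℓ} G(ω₁^ℓ), computed in ℤ[ω₁] = ℤ[x]/(Φ₅)
N₁ : Poly → ℤ
N₁ = Residue.normOver Φ₅-low (units 5)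

-- N₂(G) = ∏_{1≤ℓ≤25, 5∤ℓ} G(ω₂^ℓ), computed in ℤ[ω₂] = ℤ[x]/(Φ₂₅)
N₂ : Poly → ℤ
N₂ = Residue.normOver Φ₂₅-low (units 25)

-- M₂₅(F) = ∏_{z²⁵=1} F(z) = ∏_{0≤ℓ<25} F(ω₂^ℓ), computed in ℤ[ω₂]
M₂₅ : Poly → ℤ
M₂₅ = Residue.normOver Φ₂₅-low (applyUpTo (λ ℓ → ℓ) 25)

G₃ : Poly → Poly
G₃ h = oneₚ +ₚ (((xm1 *ₚ xm1) *ₚ xm1) *ₚ h)

module Submission where

-- Let u = 1 + x + ⋯ + x^(k-1), so that (1 - x)·u = 1 - x^k, and put
--   F = (1 - x^k)·G₃(h) + P·(u·E·h + Q·D)   with {P, Q} = {Φ₅, Φ₂₅}.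
-- At the roots of P, F = (1 - x^k)·G₃(h). At the other nontrivial 25th roots of
-- unity P·Q = 0 and P·E = (x - 1)⁴, so the terms in h and D cancel and F = 1 - x^k.
-- For 5 ∤ k every norm of 1 - ζ^k is 5, and F(1) = 5·(k·E(1)·h(1) + 5·D) = 5 once k
-- inverts ±h(1) modulo 5 and D is chosen accordingly. So one of N₁ F, N₂ F is 5, the
-- other is 5m, and M₂₅ F = F(1)·∏_{ℓ≠0} F(ζ^ℓ) = 5·5·5m. Norms are the constant
-- coefficients of products in ℤ[x]/(Φ); in case (i) the product over the ζ₂₅^(5j)
-- is carried over from ℤ[ζ₅] along x ↦ x⁵.

open import Defs
open import Data.Nat as ℕ using (ℕ; zero; suc)
import Data.Nat.Properties as ℕP
import Data.Nat.Divisibility as ℕD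
open import Data.Nat.Divisibility using (_∣?_)
open import Data.Integer using (ℤ; +_; -_; _+_; _*_; _-_; ∣_∣)
import Data.Integer.Properties as ℤP
open import Data.Integer.Divisibility using (_∣_)
open import Data.Integer.DivMod using (_%ℕ_; _/ℕ_; a≡a%ℕn+[a/ℕn]*n; n%ℕd<d)
open import Data.Integer.Tactic.RingSolver using (solve-∀)
open import Data.List as L using (List; []; _∷_)
open import Data.List.Membership.Propositional using (_∈_)
open import Data.List.Relation.Unary.Any using (here; there)
open import Data.List.Relation.Unary.All as All using (All; []; _∷_; all?)
open import Data.Vec as Vec using (Vec; []; _∷_; head; init; last; zipWith; replicate; toList)
open import Data.Vec.Properties
  using ( ≡-dec; length-toList; toList-replicate; toList-∷ʳ; toList-map; zipWith-assoc; zipWith-comm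
        ; zipWith-identityˡ; zipWith-identityʳ; map-∘; map-cong; map-id; map-const; map-replicate)
open import Data.Product using (Σ; ∃₂; _×_; _,_; proj₁; proj₂)
open import Data.Empty using (⊥-elim)
open import Function using (_∘_)
open import Function.Strict using (force; force-≡)
open import Algebra using (CommutativeSemiring)
open import Algebra.Structures using (IsCommutativeSemiring)
open import Algebra.Structures.Biased using (isCommutativeMonoidˡ; isCommutativeSemiringˡ)
import Algebra.Properties.CommutativeSemigroup as CommutativeSemigroupProperties
open import Level using (0ℓ)
open import Relation.Nullary using (¬_; yes; no; ¬?)
open import Relation.Nullary.Decidable using (True; toWitness)
open import Relation.Unary using (Pred; Decidable)
open import Relation.Binary.PropositionalEquality
open import Relation.Binary.PropositionalEquality.Algebra using (isMagma)
open ≡-Reasoning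

infixl 6 _⊕_
infixr 7 _·_

_⊕_ : ∀ {k} → Vec ℤ k → Vec ℤ k → Vec ℤ k
_⊕_ = zipWith _+_

_·_ : ∀ {k} → ℤ → Vec ℤ k → Vec ℤ k
c · v = Vec.map (c *_) v

𝟘 : ∀ {k} → Vec ℤ k
𝟘 = replicate _ (+ 0)

⊕-assoc : ∀ {k} (a b c : Vec ℤ k) → (a ⊕ b) ⊕ c ≡ a ⊕ (b ⊕ c)
⊕-assoc = zipWith-assoc ℤP.+-assoc

⊕-comm : ∀ {k} (a b : Vec ℤ k) → a ⊕ b ≡ b ⊕ a
⊕-comm = zipWith-comm ℤP.+-comm

⊕-identityˡ : ∀ {k} (a : Vec ℤ k) → 𝟘 ⊕ a ≡ a
⊕-identityˡ = zipWith-identityˡ ℤP.+-identityˡ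

⊕-identityʳ : ∀ {k} (a : Vec ℤ k) → a ⊕ 𝟘 ≡ a
⊕-identityʳ = zipWith-identityʳ ℤP.+-identityʳ

⊕-interchange : ∀ {k} (a b c d : Vec ℤ k) → (a ⊕ b) ⊕ (c ⊕ d) ≡ (a ⊕ c) ⊕ (b ⊕ d)
⊕-interchange [] [] [] [] = refl
⊕-interchange (a ∷ as) (b ∷ bs) (c ∷ cs) (d ∷ ds) =
  cong₂ _∷_ (interchange a b c d) (⊕-interchange as bs cs ds)
  where open CommutativeSemigroupProperties ℤP.+-commutativeSemigroup using (interchange)

·-distribˡ-⊕ : ∀ {k} c (a b : Vec ℤ k) → c · (a ⊕ b) ≡ c · a ⊕ c · b
·-distribˡ-⊕ c [] [] = refl
·-distribˡ-⊕ c (x ∷ a) (y ∷ b) = cong₂ _∷_ (ℤP.*-distribˡ-+ c x y) (·-distribˡ-⊕ c a b)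

·-distribʳ-+ : ∀ {k} c d (a : Vec ℤ k) → (c + d) · a ≡ c · a ⊕ d · a
·-distribʳ-+ c d [] = refl
·-distribʳ-+ c d (x ∷ a) = cong₂ _∷_ (ℤP.*-distribʳ-+ x c d) (·-distribʳ-+ c d a)

·-assoc : ∀ {k} c d (a : Vec ℤ k) → c · d · a ≡ (c * d) · a
·-assoc c d a = trans (sym (map-∘ (c *_) (d *_) a)) (map-cong (λ x → sym (ℤP.*-assoc c d x)) a)

·-identity : ∀ {k} (a : Vec ℤ k) → + 1 · a ≡ a
·-identity a = trans (map-cong ℤP.*-identityˡ a) (map-id a)

·-zeroˡ : ∀ {k} (a : Vec ℤ k) → + 0 · a ≡ 𝟘
·-zeroˡ a = trans (map-cong ℤP.*-zeroˡ a) (map-const a (+ 0))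

·-zeroʳ : ∀ {k} c → c · 𝟘 {k} ≡ 𝟘
·-zeroʳ {k} c = trans (map-replicate (c *_) (+ 0) k) (cong (replicate k) (ℤP.*-zeroʳ c))

·-neg-of-⊕≡𝟘 : ∀ {k} c (a b : Vec ℤ k) → a ⊕ b ≡ 𝟘 → c · b ≡ (- c) · a
·-neg-of-⊕≡𝟘 c a b a⊕b≡𝟘 = begin
  c · b                              ≡⟨ ⊕-identityˡ (c · b) ⟨
  𝟘 ⊕ c · b                          ≡⟨ cong (_⊕ c · b) (·-zeroʳ (- c)) ⟨
  (- c) · 𝟘 ⊕ c · b                  ≡⟨ cong (λ t → (- c) · t ⊕ c · b) a⊕b≡𝟘 ⟨
  (- c) · (a ⊕ b) ⊕ c · b            ≡⟨ cong (_⊕ c · b) (·-distribˡ-⊕ (- c) a b) ⟩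
  ((- c) · a ⊕ (- c) · b) ⊕ c · b    ≡⟨ ⊕-assoc _ _ _ ⟩
  (- c) · a ⊕ ((- c) · b ⊕ c · b)    ≡⟨ cong ((- c) · a ⊕_) (·-distribʳ-+ (- c) c b) ⟨
  (- c) · a ⊕ (- c + c) · b          ≡⟨ cong (λ t → (- c) · a ⊕ t · b) (ℤP.+-inverseˡ c) ⟩
  (- c) · a ⊕ + 0 · b                ≡⟨ cong ((- c) · a ⊕_) (·-zeroˡ b) ⟩
  (- c) · a ⊕ 𝟘                      ≡⟨ ⊕-identityʳ _ ⟩
  (- c) · a                          ∎

head-⊕ : ∀ {k} (a b : Vec ℤ (suc k)) → head (a ⊕ b) ≡ head a + head b
head-⊕ (x ∷ a) (y ∷ b) = refl

head-· : ∀ {k} c (a : Vec ℤ (suc k)) → head (c · a) ≡ c * head a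
head-· c (x ∷ a) = refl

init-⊕ : ∀ {k} (a b : Vec ℤ (suc k)) → init (a ⊕ b) ≡ init a ⊕ init b
init-⊕ {zero} (x ∷ []) (y ∷ []) = refl
init-⊕ {suc k} (x ∷ a) (y ∷ b) = cong (x + y ∷_) (init-⊕ a b)

last-⊕ : ∀ {k} (a b : Vec ℤ (suc k)) → last (a ⊕ b) ≡ last a + last b
last-⊕ {zero} (x ∷ []) (y ∷ []) = refl
last-⊕ {suc k} (x ∷ a) (y ∷ b) = last-⊕ a b

init-· : ∀ {k} c (a : Vec ℤ (suc k)) → init (c · a) ≡ c · init a
init-· {zero} c (x ∷ []) = refl
init-· {suc k} c (x ∷ a) = cong (c * x ∷_) (init-· c a)

last-· : ∀ {k} c (a : Vec ℤ (suc k)) → last (c · a) ≡ c * last a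
last-· {zero} c (x ∷ []) = refl
last-· {suc k} c (x ∷ a) = last-· c a

init-𝟘 : ∀ k → init (𝟘 {suc k}) ≡ 𝟘
init-𝟘 zero = refl
init-𝟘 (suc k) = cong (+ 0 ∷_) (init-𝟘 k)

last-𝟘 : ∀ k → last (𝟘 {suc k}) ≡ + 0
last-𝟘 zero = refl
last-𝟘 (suc k) = last-𝟘 k

toList-⊕ : ∀ {k} (a b : Vec ℤ k) → toList (a ⊕ b) ≡ toList a +ₚ toList b
toList-⊕ [] [] = refl
toList-⊕ (x ∷ a) (y ∷ b) = cong (x + y ∷_) (toList-⊕ a b)

module ResidueRing {n : ℕ} (φ : Vec ℤ (suc n)) where
  open Residue φ public

  infixr 7 _⊗_
  _⊗_ : R → R → R
  _⊗_ = _*R_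

  oneR : R
  oneR = constR (+ 1)

  mulX-⊕ : ∀ a b → mulX (a ⊕ b) ≡ mulX a ⊕ mulX b
  mulX-⊕ a b = begin
    (+ 0 ∷ init (a ⊕ b)) ⊕ (- last (a ⊕ b)) · φ
      ≡⟨ cong₂ (λ s t → (+ 0 ∷ s) ⊕ (- t) · φ) (init-⊕ a b) (last-⊕ a b) ⟩
    ((+ 0 ∷ init a) ⊕ (+ 0 ∷ init b)) ⊕ (- (last a + last b)) · φ
      ≡⟨ cong (λ t → ((+ 0 ∷ init a) ⊕ (+ 0 ∷ init b)) ⊕ t · φ) (ℤP.neg-distrib-+ (last a) (last b)) ⟩
    ((+ 0 ∷ init a) ⊕ (+ 0 ∷ init b)) ⊕ (- last a + - last b) · φ
      ≡⟨ cong (((+ 0 ∷ init a) ⊕ (+ 0 ∷ init b)) ⊕_) (·-distribʳ-+ (- last a) (- last b) φ) ⟩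
    ((+ 0 ∷ init a) ⊕ (+ 0 ∷ init b)) ⊕ ((- last a) · φ ⊕ (- last b) · φ)
      ≡⟨ ⊕-interchange _ _ _ _ ⟩
    mulX a ⊕ mulX b ∎

  mulX-· : ∀ c a → mulX (c · a) ≡ c · mulX a
  mulX-· c a = begin
    (+ 0 ∷ init (c · a)) ⊕ (- last (c · a)) · φ
      ≡⟨ cong₂ (λ s t → (+ 0 ∷ s) ⊕ (- t) · φ) (init-· c a) (last-· c a) ⟩
    (+ 0 ∷ c · init a) ⊕ (- (c * last a)) · φ
      ≡⟨ cong₂ (λ s t → (s ∷ c · init a) ⊕ t · φ) (sym (ℤP.*-zeroʳ c)) (ℤP.neg-distribʳ-* c (last a)) ⟩
    c · (+ 0 ∷ init a) ⊕ (c * - last a) · φ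
      ≡⟨ cong (c · (+ 0 ∷ init a) ⊕_) (·-assoc c (- last a) φ) ⟨
    c · (+ 0 ∷ init a) ⊕ c · (- last a) · φ
      ≡⟨ ·-distribˡ-⊕ c _ _ ⟨
    c · mulX a ∎

  mulX-zeroR : mulX zeroR ≡ zeroR
  mulX-zeroR = begin
    (+ 0 ∷ init (𝟘 {suc n})) ⊕ (- last (𝟘 {suc n})) · φ
      ≡⟨ cong₂ (λ s t → (+ 0 ∷ s) ⊕ (- t) · φ) (init-𝟘 n) (last-𝟘 n) ⟩
    zeroR ⊕ + 0 · φ ≡⟨ cong (zeroR ⊕_) (·-zeroˡ φ) ⟩
    zeroR ⊕ zeroR   ≡⟨ ⊕-identityˡ zeroR ⟩
    zeroR           ∎

  infixr 7 _⊙_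
  _⊙_ : Poly → R → R
  [] ⊙ a = zeroR
  (c ∷ p) ⊙ a = scaleR c a ⊕ mulX (p ⊙ a)

  ⊗-as-⊙ : ∀ a b → a ⊗ b ≡ toList b ⊙ a
  ⊗-as-⊙ a b = go b
    where
    go : ∀ {k} (b : Vec ℤ k) → Vec.foldr (λ _ → R) (λ c r → scaleR c a ⊕ mulX r) zeroR b ≡ toList b ⊙ a
    go [] = refl
    go (c ∷ b) = cong (λ t → scaleR c a ⊕ mulX t) (go b)

  ⊙-⊕ : ∀ p a b → p ⊙ (a ⊕ b) ≡ p ⊙ a ⊕ p ⊙ b
  ⊙-⊕ [] a b = sym (⊕-identityˡ zeroR)
  ⊙-⊕ (c ∷ p) a b = begin
    c · (a ⊕ b) ⊕ mulX (p ⊙ (a ⊕ b))              ≡⟨ cong₂ _⊕_ (·-distribˡ-⊕ c a b) (cong mulX (⊙-⊕ p a b)) ⟩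
    (c · a ⊕ c · b) ⊕ mulX (p ⊙ a ⊕ p ⊙ b)        ≡⟨ cong ((c · a ⊕ c · b) ⊕_) (mulX-⊕ _ _) ⟩
    (c · a ⊕ c · b) ⊕ (mulX (p ⊙ a) ⊕ mulX (p ⊙ b)) ≡⟨ ⊕-interchange _ _ _ _ ⟩
    (c ∷ p) ⊙ a ⊕ (c ∷ p) ⊙ b                      ∎

  ⊙-· : ∀ p c a → p ⊙ scaleR c a ≡ scaleR c (p ⊙ a)
  ⊙-· [] c a = sym (·-zeroʳ c)
  ⊙-· (d ∷ p) c a = begin
    d · c · a ⊕ mulX (p ⊙ c · a)   ≡⟨ cong₂ _⊕_ (·-assoc d c a) (cong mulX (⊙-· p c a)) ⟩
    (d * c) · a ⊕ mulX (c · p ⊙ a) ≡⟨ cong₂ _⊕_ (cong (_· a) (ℤP.*-comm d c)) (mulX-· c _) ⟩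
    (c * d) · a ⊕ c · mulX (p ⊙ a) ≡⟨ cong (_⊕ c · mulX (p ⊙ a)) (·-assoc c d a) ⟨
    c · d · a ⊕ c · mulX (p ⊙ a)   ≡⟨ ·-distribˡ-⊕ c _ _ ⟨
    c · (d ∷ p) ⊙ a                ∎

  ⊙-zeroR : ∀ p → p ⊙ zeroR ≡ zeroR
  ⊙-zeroR [] = refl
  ⊙-zeroR (c ∷ p) = begin
    c · zeroR ⊕ mulX (p ⊙ zeroR) ≡⟨ cong₂ _⊕_ (·-zeroʳ c) (trans (cong mulX (⊙-zeroR p)) mulX-zeroR) ⟩
    zeroR ⊕ zeroR                ≡⟨ ⊕-identityˡ zeroR ⟩
    zeroR                        ∎

  ⊙-mulX : ∀ p a → mulX (p ⊙ a) ≡ p ⊙ mulX a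
  ⊙-mulX [] a = mulX-zeroR
  ⊙-mulX (c ∷ p) a = begin
    mulX (c · a ⊕ mulX (p ⊙ a))         ≡⟨ mulX-⊕ _ _ ⟩
    mulX (c · a) ⊕ mulX (mulX (p ⊙ a))  ≡⟨ cong₂ _⊕_ (mulX-· c a) (cong mulX (⊙-mulX p a)) ⟩
    c · mulX a ⊕ mulX (p ⊙ mulX a)      ∎

  ⊙-⊙ : ∀ p q a → p ⊙ q ⊙ a ≡ q ⊙ p ⊙ a
  ⊙-⊙ p [] a = ⊙-zeroR p
  ⊙-⊙ p (c ∷ q) a = begin
    p ⊙ (c · a ⊕ mulX (q ⊙ a))        ≡⟨ ⊙-⊕ p _ _ ⟩
    p ⊙ c · a ⊕ p ⊙ mulX (q ⊙ a)      ≡⟨ cong₂ _⊕_ (⊙-· p c a) (sym (⊙-mulX p _)) ⟩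
    c · p ⊙ a ⊕ mulX (p ⊙ q ⊙ a)      ≡⟨ cong (λ t → c · p ⊙ a ⊕ mulX t) (⊙-⊙ p q a) ⟩
    c · p ⊙ a ⊕ mulX (q ⊙ p ⊙ a)      ∎

  pad : (k : ℕ) → List ℤ → Vec ℤ k
  pad zero _ = []
  pad (suc k) [] = + 0 ∷ pad k []
  pad (suc k) (c ∷ l) = c ∷ pad k l

  pad-[] : ∀ k → pad k [] ≡ 𝟘
  pad-[] zero = refl
  pad-[] (suc k) = cong (+ 0 ∷_) (pad-[] k)

  init-pad : ∀ k l → L.length l ℕ.≤ k → init (pad (suc k) l) ≡ pad k l
  init-pad zero [] _ = refl
  init-pad (suc k) [] _ = cong (+ 0 ∷_) (init-pad k [] ℕ.z≤n)
  init-pad (suc k) (c ∷ l) (ℕ.s≤s l≤k) = cong (c ∷_) (init-pad k l l≤k)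

  last-pad : ∀ k l → L.length l ℕ.≤ k → last (pad (suc k) l) ≡ + 0
  last-pad zero [] _ = refl
  last-pad (suc k) [] _ = last-pad k [] ℕ.z≤n
  last-pad (suc k) (c ∷ l) (ℕ.s≤s l≤k) = last-pad k l l≤k

  pad-toList : ∀ {k} (a : Vec ℤ k) → pad k (toList a) ≡ a
  pad-toList [] = refl
  pad-toList (x ∷ a) = cong (x ∷_) (pad-toList a)

  ⊙-oneR : ∀ l → L.length l ℕ.≤ suc n → l ⊙ oneR ≡ pad (suc n) l
  ⊙-oneR [] _ = sym (pad-[] (suc n))
  ⊙-oneR (c ∷ l) (ℕ.s≤s l≤n) = begin
    c · oneR ⊕ mulX (l ⊙ oneR)
      ≡⟨ cong (λ t → c · oneR ⊕ mulX t) (⊙-oneR l (ℕP.m≤n⇒m≤1+n l≤n)) ⟩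
    c · oneR ⊕ ((+ 0 ∷ init (pad (suc n) l)) ⊕ (- last (pad (suc n) l)) · φ)
      ≡⟨ cong₂ (λ s t → c · oneR ⊕ ((+ 0 ∷ s) ⊕ (- t) · φ)) (init-pad n l l≤n) (last-pad n l l≤n) ⟩
    c · oneR ⊕ ((+ 0 ∷ pad n l) ⊕ + 0 · φ)
      ≡⟨ cong (λ t → c · oneR ⊕ ((+ 0 ∷ pad n l) ⊕ t)) (·-zeroˡ φ) ⟩
    c · oneR ⊕ ((+ 0 ∷ pad n l) ⊕ zeroR)
      ≡⟨ cong (c · oneR ⊕_) (⊕-identityʳ _) ⟩
    (c * + 1 + + 0) ∷ (c · 𝟘 ⊕ pad n l)
      ≡⟨ cong₂ _∷_ (trans (ℤP.+-identityʳ _) (ℤP.*-identityʳ c)) (trans (cong (_⊕ pad n l) (·-zeroʳ c)) (⊕-identityˡ _)) ⟩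
    c ∷ pad n l ∎

  toList-⊙-oneR : ∀ a → toList a ⊙ oneR ≡ a
  toList-⊙-oneR a = trans (⊙-oneR (toList a) (ℕP.≤-reflexive (length-toList a))) (pad-toList a)

  toList-⊙-comm : ∀ a b → toList a ⊙ b ≡ toList b ⊙ a
  toList-⊙-comm a b = begin
    toList a ⊙ b                   ≡⟨ cong (toList a ⊙_) (toList-⊙-oneR b) ⟨
    toList a ⊙ toList b ⊙ oneR     ≡⟨ ⊙-⊙ (toList a) (toList b) oneR ⟩
    toList b ⊙ toList a ⊙ oneR     ≡⟨ cong (toList b ⊙_) (toList-⊙-oneR a) ⟩
    toList b ⊙ a                   ∎

  ⊗-comm : ∀ a b → a ⊗ b ≡ b ⊗ a
  ⊗-comm a b = begin
    a ⊗ b       ≡⟨ ⊗-as-⊙ a b ⟩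
    toList b ⊙ a ≡⟨ toList-⊙-comm b a ⟩
    toList a ⊙ b ≡⟨ ⊗-as-⊙ b a ⟨
    b ⊗ a       ∎

  ⊗-assoc : ∀ a b c → (a ⊗ b) ⊗ c ≡ a ⊗ (b ⊗ c)
  ⊗-assoc a b c = begin
    (a ⊗ b) ⊗ c               ≡⟨ ⊗-as-⊙ _ c ⟩
    toList c ⊙ (a ⊗ b)         ≡⟨ cong (toList c ⊙_) (⊗-comm a b) ⟩
    toList c ⊙ (b ⊗ a)         ≡⟨ cong (toList c ⊙_) (⊗-as-⊙ b a) ⟩
    toList c ⊙ toList a ⊙ b     ≡⟨ ⊙-⊙ (toList c) (toList a) b ⟩
    toList a ⊙ toList c ⊙ b     ≡⟨ cong (toList a ⊙_) (⊗-as-⊙ b c) ⟨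
    toList a ⊙ (b ⊗ c)         ≡⟨ toList-⊙-comm a (b ⊗ c) ⟩
    toList (b ⊗ c) ⊙ a         ≡⟨ ⊗-as-⊙ a (b ⊗ c) ⟨
    a ⊗ (b ⊗ c)               ∎

  ⊗-distribʳ : ∀ a b c → (b ⊕ c) ⊗ a ≡ b ⊗ a ⊕ c ⊗ a
  ⊗-distribʳ a b c = begin
    (b ⊕ c) ⊗ a                ≡⟨ ⊗-as-⊙ _ a ⟩
    toList a ⊙ (b ⊕ c)          ≡⟨ ⊙-⊕ (toList a) b c ⟩
    toList a ⊙ b ⊕ toList a ⊙ c ≡⟨ cong₂ _⊕_ (⊗-as-⊙ b a) (⊗-as-⊙ c a) ⟨
    b ⊗ a ⊕ c ⊗ a             ∎

  ⊗-identityˡ : ∀ a → oneR ⊗ a ≡ a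
  ⊗-identityˡ a = trans (⊗-as-⊙ oneR a) (toList-⊙-oneR a)

  ⊗-zeroˡ : ∀ a → zeroR ⊗ a ≡ zeroR
  ⊗-zeroˡ a = trans (⊗-as-⊙ zeroR a) (⊙-zeroR (toList a))

  isCommutativeSemiring : IsCommutativeSemiring _≡_ _⊕_ _⊗_ zeroR oneR
  isCommutativeSemiring = isCommutativeSemiringˡ record
    { +-isCommutativeMonoid = isCommutativeMonoidˡ record
      { isSemigroup = record { isMagma = isMagma _⊕_ ; assoc = ⊕-assoc }
      ; identityˡ = ⊕-identityˡ
      ; comm = ⊕-comm
      }
    ; *-isCommutativeMonoid = isCommutativeMonoidˡ record
      { isSemigroup = record { isMagma = isMagma _⊗_ ; assoc = ⊗-assoc }
      ; identityˡ = ⊗-identityˡ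
      ; comm = ⊗-comm
      }
    ; distribʳ = ⊗-distribʳ
    ; zeroˡ = ⊗-zeroˡ
    }

  commutativeSemiring : CommutativeSemiring 0ℓ 0ℓ
  commutativeSemiring = record { isCommutativeSemiring = isCommutativeSemiring }

  open CommutativeSemiring commutativeSemiring public
    using (*-commutativeSemigroup) renaming (*-identityʳ to ⊗-identityʳ; zeroʳ to ⊗-zeroʳ; distribˡ to ⊗-distribˡ)
  open CommutativeSemigroupProperties *-commutativeSemigroup using (x∙yz≈y∙xz; x∙yz≈yx∙z) renaming (interchange to ⊗-interchange)
  open import Algebra.Solver.Ring.NaturalCoefficients.Default commutativeSemiring

  ·-⊗ : ∀ c a b → (c · a) ⊗ b ≡ c · (a ⊗ b)
  ·-⊗ c a b = begin
    (c · a) ⊗ b           ≡⟨ ⊗-as-⊙ _ b ⟩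
    toList b ⊙ c · a      ≡⟨ ⊙-· (toList b) c a ⟩
    c · toList b ⊙ a      ≡⟨ cong (c ·_) (⊗-as-⊙ a b) ⟨
    c · (a ⊗ b)           ∎

  ⊗-· : ∀ c a b → a ⊗ (c · b) ≡ c · (a ⊗ b)
  ⊗-· c a b = trans (⊗-comm a _) (trans (·-⊗ c b a) (cong (c ·_) (⊗-comm b a)))

  constR-as-· : ∀ c → constR c ≡ c · oneR
  constR-as-· c = cong₂ _∷_ (sym (ℤP.*-identityʳ c)) (sym (·-zeroʳ c))

  constR-⊗ : ∀ c a → constR c ⊗ a ≡ c · a
  constR-⊗ c a = begin
    constR c ⊗ a      ≡⟨ cong (_⊗ a) (constR-as-· c) ⟩
    (c · oneR) ⊗ a    ≡⟨ ·-⊗ c oneR a ⟩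
    c · (oneR ⊗ a)    ≡⟨ cong (c ·_) (⊗-identityˡ a) ⟩
    c · a             ∎

  constR-+ : ∀ a b → constR (a + b) ≡ constR a ⊕ constR b
  constR-+ a b = cong (a + b ∷_) (sym (⊕-identityˡ 𝟘))

  constR-* : ∀ a b → constR a ⊗ constR b ≡ constR (a * b)
  constR-* a b = trans (constR-⊗ a (constR b)) (cong (a * b ∷_) (·-zeroʳ a))

  head-constR-⊗ : ∀ c a → head (constR c ⊗ a) ≡ c * head a
  head-constR-⊗ c a = trans (cong head (constR-⊗ c a)) (head-· c a)

  evalR-+ₚ : ∀ p q y → evalR (p +ₚ q) y ≡ evalR p y ⊕ evalR q y
  evalR-+ₚ [] q y = sym (⊕-identityˡ _)
  evalR-+ₚ (a ∷ p) [] y = sym (⊕-identityʳ _)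
  evalR-+ₚ (a ∷ p) (b ∷ q) y = begin
    constR (a + b) ⊕ y ⊗ evalR (p +ₚ q) y
      ≡⟨ cong₂ (λ s t → s ⊕ y ⊗ t) (constR-+ a b) (evalR-+ₚ p q y) ⟩
    (constR a ⊕ constR b) ⊕ y ⊗ (evalR p y ⊕ evalR q y)
      ≡⟨ cong ((constR a ⊕ constR b) ⊕_) (⊗-distribˡ y (evalR p y) (evalR q y)) ⟩
    (constR a ⊕ constR b) ⊕ (y ⊗ evalR p y ⊕ y ⊗ evalR q y)
      ≡⟨ ⊕-interchange _ _ _ _ ⟩
    evalR (a ∷ p) y ⊕ evalR (b ∷ q) y ∎

  evalR-scaleₚ : ∀ c p y → evalR (scaleₚ c p) y ≡ c · evalR p y
  evalR-scaleₚ c [] y = sym (·-zeroʳ c)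
  evalR-scaleₚ c (a ∷ p) y = begin
    constR (c * a) ⊕ y ⊗ evalR (scaleₚ c p) y
      ≡⟨ cong₂ (λ s t → s ⊕ y ⊗ t) (cong (c * a ∷_) (sym (·-zeroʳ c))) (evalR-scaleₚ c p y) ⟩
    c · constR a ⊕ y ⊗ (c · evalR p y)
      ≡⟨ cong (c · constR a ⊕_) (⊗-· c y (evalR p y)) ⟩
    c · constR a ⊕ c · (y ⊗ evalR p y)
      ≡⟨ ·-distribˡ-⊕ c _ _ ⟨
    c · evalR (a ∷ p) y ∎

  evalR-*ₚ : ∀ p q y → evalR (p *ₚ q) y ≡ evalR p y ⊗ evalR q y
  evalR-*ₚ [] q y = sym (⊗-zeroˡ (evalR q y))
  evalR-*ₚ (c ∷ p) q y = begin
    evalR (scaleₚ c q +ₚ (+ 0 ∷ p *ₚ q)) y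
      ≡⟨ evalR-+ₚ (scaleₚ c q) _ y ⟩
    evalR (scaleₚ c q) y ⊕ (zeroR ⊕ y ⊗ evalR (p *ₚ q) y)
      ≡⟨ cong₂ _⊕_ (evalR-scaleₚ c q y) (⊕-identityˡ _) ⟩
    c · evalR q y ⊕ y ⊗ evalR (p *ₚ q) y
      ≡⟨ cong₂ (λ s t → s ⊕ y ⊗ t) (sym (constR-⊗ c (evalR q y))) (evalR-*ₚ p q y) ⟩
    constR c ⊗ evalR q y ⊕ y ⊗ (evalR p y ⊗ evalR q y)
      ≡⟨ solve 4 (λ C Q Y P → C :* Q :+ Y :* (P :* Q) := (C :+ Y :* P) :* Q) refl (constR c) (evalR q y) y (evalR p y) ⟩
    evalR (c ∷ p) y ⊗ evalR q y ∎

  evalR-constR : ∀ p a → evalR p (constR a) ≡ constR (evalℤ p a)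
  evalR-constR [] a = refl
  evalR-constR (c ∷ p) a = begin
    constR c ⊕ constR a ⊗ evalR p (constR a) ≡⟨ cong (λ t → constR c ⊕ constR a ⊗ t) (evalR-constR p a) ⟩
    constR c ⊕ constR a ⊗ constR (evalℤ p a) ≡⟨ cong (constR c ⊕_) (constR-* a (evalℤ p a)) ⟩
    constR c ⊕ constR (a * evalℤ p a)        ≡⟨ constR-+ c (a * evalℤ p a) ⟨
    constR (evalℤ (c ∷ p) a)                 ∎

  infixr 8 _^R_
  _^R_ : R → ℕ → R
  y ^R zero = oneR
  y ^R suc j = y ⊗ y ^R j

  mulX-as-⊗ : ∀ a → mulX a ≡ powX 1 ⊗ a
  mulX-as-⊗ a = begin
    mulX a                       ≡⟨ cong mulX (⊗-identityˡ a) ⟨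
    mulX (oneR ⊗ a)              ≡⟨ cong mulX (⊗-as-⊙ oneR a) ⟩
    mulX (toList a ⊙ oneR)       ≡⟨ ⊙-mulX (toList a) oneR ⟩
    toList a ⊙ mulX oneR         ≡⟨ ⊗-as-⊙ (powX 1) a ⟨
    powX 1 ⊗ a                   ∎

  powX-+ : ∀ i j → powX (i ℕ.+ j) ≡ powX i ⊗ powX j
  powX-+ zero j = sym (⊗-identityˡ (powX j))
  powX-+ (suc i) j = begin
    mulX (powX (i ℕ.+ j))        ≡⟨ cong mulX (powX-+ i j) ⟩
    mulX (powX i ⊗ powX j)       ≡⟨ mulX-as-⊗ _ ⟩
    powX 1 ⊗ (powX i ⊗ powX j)   ≡⟨ ⊗-assoc (powX 1) (powX i) (powX j) ⟨
    (powX 1 ⊗ powX i) ⊗ powX j   ≡⟨ cong (_⊗ powX j) (mulX-as-⊗ (powX i)) ⟨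
    powX (suc i) ⊗ powX j        ∎

  powX-^R : ∀ d j → powX d ^R j ≡ powX (d ℕ.* j)
  powX-^R d zero = cong powX (sym (ℕP.*-zeroʳ d))
  powX-^R d (suc j) = begin
    powX d ⊗ powX d ^R j       ≡⟨ cong (powX d ⊗_) (powX-^R d j) ⟩
    powX d ⊗ powX (d ℕ.* j)    ≡⟨ powX-+ d (d ℕ.* j) ⟨
    powX (d ℕ.+ d ℕ.* j)       ≡⟨ cong powX (ℕP.*-suc d j) ⟨
    powX (d ℕ.* suc j)         ∎

  evalR-∷ʳ : ∀ p c y → evalR (p L.∷ʳ c) y ≡ evalR p y ⊕ c · y ^R L.length p
  evalR-∷ʳ [] c y = begin
    constR c ⊕ y ⊗ zeroR  ≡⟨ cong (constR c ⊕_) (⊗-zeroʳ y) ⟩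
    constR c ⊕ zeroR      ≡⟨ ⊕-identityʳ _ ⟩
    constR c              ≡⟨ constR-as-· c ⟩
    c · oneR              ≡⟨ ⊕-identityˡ _ ⟨
    zeroR ⊕ c · oneR      ∎
  evalR-∷ʳ (a ∷ p) c y = begin
    constR a ⊕ y ⊗ evalR (p L.∷ʳ c) y
      ≡⟨ cong (λ t → constR a ⊕ y ⊗ t) (evalR-∷ʳ p c y) ⟩
    constR a ⊕ y ⊗ (evalR p y ⊕ c · y ^R L.length p)
      ≡⟨ cong (constR a ⊕_) (⊗-distribˡ y (evalR p y) (c · y ^R L.length p)) ⟩
    constR a ⊕ (y ⊗ evalR p y ⊕ y ⊗ (c · y ^R L.length p))
      ≡⟨ cong (λ t → constR a ⊕ (y ⊗ evalR p y ⊕ t)) (⊗-· c y (y ^R L.length p)) ⟩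
    constR a ⊕ (y ⊗ evalR p y ⊕ c · y ^R L.length (a ∷ p))
      ≡⟨ ⊕-assoc (constR a) (y ⊗ evalR p y) (c · y ^R L.length (a ∷ p)) ⟨
    evalR (a ∷ p) y ⊕ c · y ^R L.length (a ∷ p) ∎

  cancellation : ∀ O U K H P E Q D X → P ⊗ E ≡ K ⊗ X → P ⊗ Q ≡ zeroR → O ⊕ X ≡ zeroR →
                 (O ⊗ U) ⊗ (oneR ⊕ K ⊗ H) ⊕ P ⊗ ((U ⊗ E) ⊗ H ⊕ Q ⊗ D) ≡ O ⊗ U
  cancellation O U K H P E Q D X PE≡KX PQ≡0 O⊕X≡0 = begin
    (O ⊗ U) ⊗ (oneR ⊕ K ⊗ H) ⊕ P ⊗ ((U ⊗ E) ⊗ H ⊕ Q ⊗ D)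
      ≡⟨ solve 9 (λ O U K H P E Q D X → (O :* U) :* (con 1 :+ K :* H) :+ P :* ((U :* E) :* H :+ Q :* D)
                                      := O :* U :+ ((U :* (K :* H)) :* O :+ ((U :* H) :* (P :* E) :+ (P :* Q) :* D)))
                 refl O U K H P E Q D X ⟩
    O ⊗ U ⊕ ((U ⊗ K ⊗ H) ⊗ O ⊕ ((U ⊗ H) ⊗ (P ⊗ E) ⊕ (P ⊗ Q) ⊗ D))
      ≡⟨ cong₂ (λ s t → O ⊗ U ⊕ ((U ⊗ K ⊗ H) ⊗ O ⊕ ((U ⊗ H) ⊗ s ⊕ t ⊗ D))) PE≡KX PQ≡0 ⟩
    O ⊗ U ⊕ ((U ⊗ K ⊗ H) ⊗ O ⊕ ((U ⊗ H) ⊗ (K ⊗ X) ⊕ zeroR ⊗ D))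
      ≡⟨ cong (λ t → O ⊗ U ⊕ ((U ⊗ K ⊗ H) ⊗ O ⊕ t)) (trans (cong ((U ⊗ H) ⊗ (K ⊗ X) ⊕_) (⊗-zeroˡ D)) (⊕-identityʳ _)) ⟩
    O ⊗ U ⊕ ((U ⊗ K ⊗ H) ⊗ O ⊕ (U ⊗ H) ⊗ (K ⊗ X))
      ≡⟨ solve 5 (λ O U K H X → O :* U :+ ((U :* (K :* H)) :* O :+ (U :* H) :* (K :* X)) := O :* U :+ (U :* (K :* H)) :* (O :+ X))
                 refl O U K H X ⟩
    O ⊗ U ⊕ (U ⊗ K ⊗ H) ⊗ (O ⊕ X)
      ≡⟨ cong (λ t → O ⊗ U ⊕ (U ⊗ K ⊗ H) ⊗ t) O⊕X≡0 ⟩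
    O ⊗ U ⊕ (U ⊗ K ⊗ H) ⊗ zeroR
      ≡⟨ trans (cong (O ⊗ U ⊕_) (⊗-zeroʳ (U ⊗ K ⊗ H))) (⊕-identityʳ (O ⊗ U)) ⟩
    O ⊗ U ∎

  AgreeAt : Poly → Poly → List ℕ → Set
  AgreeAt p q L = All (λ ℓ → evalR p (powX ℓ) ≡ evalR q (powX ℓ)) L

  VanishesAt : Poly → List ℕ → Set
  VanishesAt p = AgreeAt p []

  prodOver : (ℕ → R) → List ℕ → R
  prodOver f = L.foldr (λ ℓ r → f ℓ ⊗ r) oneR

  prodOver-cong : ∀ {f g : ℕ → R} {L} → All (λ ℓ → f ℓ ≡ g ℓ) L → prodOver f L ≡ prodOver g L
  prodOver-cong [] = refl
  prodOver-cong (e ∷ es) = cong₂ _⊗_ e (prodOver-cong es)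

  prodOver-⊗ : ∀ (f g : ℕ → R) L → prodOver (λ ℓ → f ℓ ⊗ g ℓ) L ≡ prodOver f L ⊗ prodOver g L
  prodOver-⊗ f g [] = sym (⊗-identityˡ oneR)
  prodOver-⊗ f g (ℓ ∷ L) = begin
    (f ℓ ⊗ g ℓ) ⊗ prodOver (λ i → f i ⊗ g i) L  ≡⟨ cong ((f ℓ ⊗ g ℓ) ⊗_) (prodOver-⊗ f g L) ⟩
    (f ℓ ⊗ g ℓ) ⊗ (prodOver f L ⊗ prodOver g L) ≡⟨ ⊗-interchange (f ℓ) (g ℓ) (prodOver f L) (prodOver g L) ⟩
    (f ℓ ⊗ prodOver f L) ⊗ (g ℓ ⊗ prodOver g L) ∎

  prodOver-partition : ∀ {p} {P : Pred ℕ p} (P? : Decidable P) f L →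
    prodOver f L ≡ prodOver f (L.filter P? L) ⊗ prodOver f (L.filter (¬? ∘ P?) L)
  prodOver-partition P? f [] = sym (⊗-identityˡ oneR)
  prodOver-partition P? f (ℓ ∷ L) with P? ℓ
  ... | yes _ = trans (cong (f ℓ ⊗_) (prodOver-partition P? f L))
      (sym (⊗-assoc (f ℓ) (prodOver f (L.filter P? L)) (prodOver f (L.filter (¬? ∘ P?) L))))
  ... | no _  = trans (cong (f ℓ ⊗_) (prodOver-partition P? f L))
      (x∙yz≈y∙xz (f ℓ) (prodOver f (L.filter P? L)) (prodOver f (L.filter (¬? ∘ P?) L)))

  prodConj-map-* : ∀ d L G → prodConj (L.map (d ℕ.*_) L) G ≡ prodOver (λ ℓ → evalR G (powX d ^R ℓ)) L
  prodConj-map-* d [] G = refl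
  prodConj-map-* d (ℓ ∷ L) G = cong₂ _⊗_ (cong (evalR G) (sym (powX-^R d ℓ))) (prodConj-map-* d L G)

  head-constR-⊗³ : ∀ a b c z → head (constR a ⊗ constR b ⊗ constR c ⊗ z) ≡ a * (b * (c * head z))
  head-constR-⊗³ a b c z = begin
    head (constR a ⊗ constR b ⊗ constR c ⊗ z) ≡⟨ head-constR-⊗ a (constR b ⊗ constR c ⊗ z) ⟩
    a * head (constR b ⊗ constR c ⊗ z)        ≡⟨ cong (a *_) (head-constR-⊗ b (constR c ⊗ z)) ⟩
    a * (b * head (constR c ⊗ z))             ≡⟨ cong (λ t → a * (b * t)) (head-constR-⊗ c z) ⟩
    a * (b * (c * head z))                    ∎

  head-^R-⊗-evalR : ∀ y p j → (∀ i → i ℕ.< L.length p → head (y ^R (j ℕ.+ i)) ≡ + 0) →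
                    head (y ^R j ⊗ evalR p y) ≡ + 0
  head-^R-⊗-evalR y [] j _ = cong head (⊗-zeroʳ (y ^R j))
  head-^R-⊗-evalR y (c ∷ p) j vanish = begin
    head (y ^R j ⊗ (constR c ⊕ y ⊗ evalR p y))
      ≡⟨ cong head (⊗-distribˡ (y ^R j) (constR c) (y ⊗ evalR p y)) ⟩
    head (y ^R j ⊗ constR c ⊕ y ^R j ⊗ (y ⊗ evalR p y))
      ≡⟨ cong₂ (λ s t → head (s ⊕ t)) (trans (⊗-comm (y ^R j) (constR c)) (constR-⊗ c (y ^R j))) (x∙yz≈yx∙z (y ^R j) y (evalR p y)) ⟩
    head (c · y ^R j ⊕ (y ⊗ y ^R j) ⊗ evalR p y)
      ≡⟨ head-⊕ (c · y ^R j) _ ⟩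
    head (c · y ^R j) + head ((y ⊗ y ^R j) ⊗ evalR p y)
      ≡⟨ cong₂ _+_ (trans (head-· c (y ^R j)) (cong (c *_) lowest)) (head-^R-⊗-evalR y p (suc j) higher) ⟩
    c * + 0 + + 0
      ≡⟨ trans (ℤP.+-identityʳ (c * + 0)) (ℤP.*-zeroʳ c) ⟩
    + 0 ∎
    where
    lowest : head (y ^R j) ≡ + 0
    lowest = subst (λ i → head (y ^R i) ≡ + 0) (ℕP.+-identityʳ j) (vanish 0 (ℕ.s≤s ℕ.z≤n))
    higher : ∀ i → i ℕ.< L.length p → head (y ^R (suc j ℕ.+ i)) ≡ + 0
    higher i i<p = subst (λ k → head (y ^R k) ≡ + 0) (ℕP.+-suc j i) (vanish (suc i) (ℕ.s≤s i<p))

  head-evalR : ∀ y c p → (∀ i → i ℕ.< L.length p → head (y ^R suc i) ≡ + 0) → head (evalR (c ∷ p) y) ≡ c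
  head-evalR y c p vanish = begin
    head (constR c ⊕ y ⊗ evalR p y)      ≡⟨ head-⊕ (constR c) (y ⊗ evalR p y) ⟩
    c + head (y ⊗ evalR p y)             ≡⟨ cong (λ t → c + head (t ⊗ evalR p y)) (⊗-identityʳ y) ⟨
    c + head (y ^R 1 ⊗ evalR p y)        ≡⟨ cong (λ t → c + t) (head-^R-⊗-evalR y p 1 vanish) ⟩
    c + + 0                              ≡⟨ ℤP.+-identityʳ c ⟩
    c                                    ∎

  evalR-replicate-0 : ∀ k y → evalR (L.replicate k (+ 0)) y ≡ zeroR
  evalR-replicate-0 zero y = refl
  evalR-replicate-0 (suc k) y = begin
    zeroR ⊕ y ⊗ evalR (L.replicate k (+ 0)) y ≡⟨ ⊕-identityˡ _ ⟩
    y ⊗ evalR (L.replicate k (+ 0)) y         ≡⟨ cong (y ⊗_) (evalR-replicate-0 k y) ⟩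
    y ⊗ zeroR                                 ≡⟨ ⊗-zeroʳ y ⟩
    zeroR                                     ∎

module Substitution {n m : ℕ} (φ : Vec ℤ (suc n)) (ϑ : Vec ℤ (suc m)) (y : Vec ℤ (suc m))
                    (root : ResidueRing.evalR ϑ (toList φ L.∷ʳ + 1) y ≡ ResidueRing.zeroR ϑ) where
  private module S = ResidueRing φ
  open ResidueRing ϑ

  ψ : S.R → R
  ψ a = evalR (toList a) y

  ψ-⊕ : ∀ a b → ψ (a ⊕ b) ≡ ψ a ⊕ ψ b
  ψ-⊕ a b = trans (cong (λ l → evalR l y) (toList-⊕ a b)) (evalR-+ₚ (toList a) (toList b) y)

  ψ-· : ∀ c a → ψ (c · a) ≡ c · ψ a
  ψ-· c a = trans (cong (λ l → evalR l y) (toList-map (c *_) a)) (evalR-scaleₚ c (toList a) y)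

  ψ-zeroR : ψ S.zeroR ≡ zeroR
  ψ-zeroR = trans (cong (λ l → evalR l y) (toList-replicate (suc n) (+ 0))) (evalR-replicate-0 (suc n) y)

  ψ-constR : ∀ c → ψ (S.constR c) ≡ constR c
  ψ-constR c = begin
    constR c ⊕ y ⊗ evalR (toList (𝟘 {n})) y ≡⟨ cong (λ l → constR c ⊕ y ⊗ evalR l y) (toList-replicate n (+ 0)) ⟩
    constR c ⊕ y ⊗ evalR (L.replicate n (+ 0)) y ≡⟨ cong (λ t → constR c ⊕ y ⊗ t) (evalR-replicate-0 n y) ⟩
    constR c ⊕ y ⊗ zeroR                         ≡⟨ cong (constR c ⊕_) (⊗-zeroʳ y) ⟩
    constR c ⊕ zeroR                             ≡⟨ ⊕-identityʳ _ ⟩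
    constR c                                     ∎

  y^[1+n] : ∀ c → c · y ^R suc n ≡ (- c) · evalR (toList φ) y
  y^[1+n] c = ·-neg-of-⊕≡𝟘 c (evalR (toList φ) y) (y ^R suc n) (begin
    evalR (toList φ) y ⊕ y ^R suc n
      ≡⟨ cong (evalR (toList φ) y ⊕_) (·-identity (y ^R suc n)) ⟨
    evalR (toList φ) y ⊕ + 1 · y ^R suc n
      ≡⟨ cong (λ k → evalR (toList φ) y ⊕ + 1 · y ^R k) (length-toList φ) ⟨
    evalR (toList φ) y ⊕ + 1 · y ^R L.length (toList φ)
      ≡⟨ evalR-∷ʳ (toList φ) (+ 1) y ⟨
    evalR (toList φ L.∷ʳ + 1) y
      ≡⟨ root ⟩
    zeroR ∎)

  ψ-mulX : ∀ a → ψ (S.mulX a) ≡ y ⊗ ψ a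
  ψ-mulX a = begin
    ψ ((+ 0 ∷ init a) ⊕ (- c) · φ)                 ≡⟨ ψ-⊕ (+ 0 ∷ init a) ((- c) · φ) ⟩
    ψ (+ 0 ∷ init a) ⊕ ψ ((- c) · φ)               ≡⟨ cong (ψ (+ 0 ∷ init a) ⊕_) (ψ-· (- c) φ) ⟩
    (zeroR ⊕ y ⊗ e) ⊕ (- c) · evalR (toList φ) y    ≡⟨ cong₂ _⊕_ (sym (⊕-identityˡ (y ⊗ e))) (y^[1+n] c) ⟨
    y ⊗ e ⊕ c · y ^R suc n                          ≡⟨ cong (y ⊗ e ⊕_) (⊗-· c y (y ^R n)) ⟨
    y ⊗ e ⊕ y ⊗ c · y ^R n                          ≡⟨ ⊗-distribˡ y e (c · y ^R n) ⟨
    y ⊗ (e ⊕ c · y ^R n)                            ≡⟨ cong (λ k → y ⊗ (e ⊕ c · y ^R k)) (length-toList (init a)) ⟨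
    y ⊗ (e ⊕ c · y ^R L.length (toList (init a)))   ≡⟨ cong (y ⊗_) (evalR-∷ʳ (toList (init a)) c y) ⟨
    y ⊗ evalR (toList (init a) L.∷ʳ c) y            ≡⟨ cong (λ l → y ⊗ evalR l y) (toList-∷ʳ c (init a)) ⟨
    y ⊗ ψ (init a Vec.∷ʳ c)                         ≡⟨ cong (λ v → y ⊗ ψ v) (proj₂ (proj₂ (Vec.initLast a))) ⟨
    y ⊗ ψ a                                         ∎
    where
    c = last a
    e = evalR (toList (init a)) y

  ψ-⊙ : ∀ p a → ψ (p S.⊙ a) ≡ evalR p y ⊗ ψ a
  ψ-⊙ [] a = trans ψ-zeroR (sym (⊗-zeroˡ (ψ a)))
  ψ-⊙ (c ∷ p) a = begin
    ψ (c · a ⊕ S.mulX (p S.⊙ a))                 ≡⟨ ψ-⊕ (c · a) (S.mulX (p S.⊙ a)) ⟩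
    ψ (c · a) ⊕ ψ (S.mulX (p S.⊙ a))             ≡⟨ cong₂ _⊕_ (ψ-· c a) (ψ-mulX (p S.⊙ a)) ⟩
    c · ψ a ⊕ y ⊗ ψ (p S.⊙ a)                    ≡⟨ cong₂ (λ s t → s ⊕ y ⊗ t) (sym (constR-⊗ c (ψ a))) (ψ-⊙ p a) ⟩
    constR c ⊗ ψ a ⊕ y ⊗ evalR p y ⊗ ψ a         ≡⟨ cong (constR c ⊗ ψ a ⊕_) (⊗-assoc y (evalR p y) (ψ a)) ⟨
    constR c ⊗ ψ a ⊕ (y ⊗ evalR p y) ⊗ ψ a       ≡⟨ ⊗-distribʳ (ψ a) (constR c) (y ⊗ evalR p y) ⟨
    evalR (c ∷ p) y ⊗ ψ a                        ∎

  ψ-⊗ : ∀ a b → ψ (a S.⊗ b) ≡ ψ a ⊗ ψ b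
  ψ-⊗ a b = begin
    ψ (a S.⊗ b)          ≡⟨ cong ψ (S.⊗-as-⊙ a b) ⟩
    ψ (toList b S.⊙ a)   ≡⟨ ψ-⊙ (toList b) a ⟩
    ψ b ⊗ ψ a            ≡⟨ ⊗-comm (ψ b) (ψ a) ⟩
    ψ a ⊗ ψ b            ∎

  ψ-evalR : ∀ p z → ψ (S.evalR p z) ≡ evalR p (ψ z)
  ψ-evalR [] z = ψ-zeroR
  ψ-evalR (c ∷ p) z = begin
    ψ (S.constR c ⊕ z S.⊗ S.evalR p z)         ≡⟨ ψ-⊕ (S.constR c) (z S.⊗ S.evalR p z) ⟩
    ψ (S.constR c) ⊕ ψ (z S.⊗ S.evalR p z)     ≡⟨ cong₂ _⊕_ (ψ-constR c) (ψ-⊗ z (S.evalR p z)) ⟩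
    constR c ⊕ ψ z ⊗ ψ (S.evalR p z)           ≡⟨ cong (λ t → constR c ⊕ ψ z ⊗ t) (ψ-evalR p z) ⟩
    evalR (c ∷ p) (ψ z)                        ∎

  ψ-powX : ∀ j → ψ (S.powX j) ≡ y ^R j
  ψ-powX zero = ψ-constR (+ 1)
  ψ-powX (suc j) = trans (ψ-mulX (S.powX j)) (cong (y ⊗_) (ψ-powX j))

  ψ-prodConj : ∀ L G → ψ (S.prodConj L G) ≡ prodOver (λ ℓ → evalR G (y ^R ℓ)) L
  ψ-prodConj [] G = ψ-constR (+ 1)
  ψ-prodConj (ℓ ∷ L) G = begin
    ψ (S.evalR G (S.powX ℓ) S.⊗ S.prodConj L G)      ≡⟨ ψ-⊗ (S.evalR G (S.powX ℓ)) (S.prodConj L G) ⟩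
    ψ (S.evalR G (S.powX ℓ)) ⊗ ψ (S.prodConj L G)    ≡⟨ cong₂ _⊗_ (trans (ψ-evalR G (S.powX ℓ)) (cong (evalR G) (ψ-powX ℓ))) (ψ-prodConj L G) ⟩
    evalR G (y ^R ℓ) ⊗ prodOver (λ i → evalR G (y ^R i)) L ∎

  head-ψ : (∀ i → i ℕ.< n → head (y ^R suc i) ≡ + 0) → ∀ a → head (ψ a) ≡ head a
  head-ψ vanish (c ∷ a) = head-evalR y c (toList a) (λ i i<a → vanish i (subst (i ℕ.<_) (length-toList a) i<a))

oneMinusX : Poly
oneMinusX = + 1 ∷ - (+ 1) ∷ []

geometric : ℕ → Poly
geometric k = L.replicate k (+ 1)

oneMinusXᵏ : ℕ → Poly
oneMinusXᵏ k = oneMinusX *ₚ geometric k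

[x-1]³ : Poly
[x-1]³ = (xm1 *ₚ xm1) *ₚ xm1

[x-1]⁴ : Poly
[x-1]⁴ = [x-1]³ *ₚ xm1

candidate : (P Q E : Poly) (k : ℕ) (D : ℤ) (h : Poly) → Poly
candidate P Q E k D h = (oneMinusXᵏ k *ₚ G₃ h) +ₚ (P *ₚ (((geometric k *ₚ E) *ₚ h) +ₚ (Q *ₚ (D ∷ []))))

module CandidateValues {n : ℕ} (φ : Vec ℤ (suc n)) (P Q E : Poly) (k : ℕ) (D : ℤ) (h : Poly) where
  open ResidueRing φ

  evalR-constant : ∀ c y → evalR (c ∷ []) y ≡ constR c
  evalR-constant c y = trans (cong (constR c ⊕_) (⊗-zeroʳ y)) (⊕-identityʳ (constR c))

  oneMinusX⊕xm1 : ∀ y → evalR oneMinusX y ⊕ evalR xm1 y ≡ zeroR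
  oneMinusX⊕xm1 y = trans (sym (evalR-+ₚ oneMinusX xm1 y)) (evalR-replicate-0 2 y)

  module _ (y : R) where
    private
      A : R
      A = evalR (oneMinusXᵏ k) y
      G : R
      G = evalR (G₃ h) y
      Pv : R
      Pv = evalR P y
      rest : R
      rest = evalR (((geometric k *ₚ E) *ₚ h) +ₚ (Q *ₚ (D ∷ []))) y

    evalR-candidate : evalR (candidate P Q E k D h) y ≡ A ⊗ G ⊕ Pv ⊗ rest
    evalR-candidate = trans (evalR-+ₚ (oneMinusXᵏ k *ₚ G₃ h) _ y) (cong₂ _⊕_ (evalR-*ₚ (oneMinusXᵏ k) (G₃ h) y) (evalR-*ₚ P _ y))

    candidate-at-root : Pv ≡ zeroR → evalR (candidate P Q E k D h) y ≡ A ⊗ G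
    candidate-at-root Pv≡0 = begin
      evalR (candidate P Q E k D h) y ≡⟨ evalR-candidate ⟩
      A ⊗ G ⊕ Pv ⊗ rest               ≡⟨ cong (λ t → A ⊗ G ⊕ t ⊗ rest) Pv≡0 ⟩
      A ⊗ G ⊕ zeroR ⊗ rest            ≡⟨ cong (A ⊗ G ⊕_) (⊗-zeroˡ rest) ⟩
      A ⊗ G ⊕ zeroR                   ≡⟨ ⊕-identityʳ (A ⊗ G) ⟩
      A ⊗ G                           ∎

    -- Off the roots of P, with P·E = (x - 1)⁴ the coefficient of h is
    -- u·(x - 1)³·((1 - x) + (x - 1)) = 0, and the D-term carries the factor P·Q = 0.
    candidate-off-root : evalR (P *ₚ E) y ≡ evalR [x-1]⁴ y → evalR (P *ₚ Q) y ≡ zeroR →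
                         evalR (candidate P Q E k D h) y ≡ A
    candidate-off-root PE≡[x-1]⁴ PQ≡0 = begin
      evalR (candidate P Q E k D h) y
        ≡⟨ evalR-candidate ⟩
      A ⊗ G ⊕ Pv ⊗ rest
        ≡⟨ cong₂ (λ s t → s ⊗ G ⊕ Pv ⊗ t) (evalR-*ₚ oneMinusX (geometric k) y) rest-atoms ⟩
      (O ⊗ U) ⊗ G ⊕ Pv ⊗ ((U ⊗ Ev) ⊗ H ⊕ Qv ⊗ constR D)
        ≡⟨ cong (λ t → (O ⊗ U) ⊗ t ⊕ Pv ⊗ ((U ⊗ Ev) ⊗ H ⊕ Qv ⊗ constR D)) G-atoms ⟩
      (O ⊗ U) ⊗ (oneR ⊕ K ⊗ H) ⊕ Pv ⊗ ((U ⊗ Ev) ⊗ H ⊕ Qv ⊗ constR D)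
        ≡⟨ cancellation O U K H Pv Ev Qv (constR D) X PE PQ (oneMinusX⊕xm1 y) ⟩
      O ⊗ U
        ≡⟨ evalR-*ₚ oneMinusX (geometric k) y ⟨
      A ∎
      where
      O : R
      O = evalR oneMinusX y
      U : R
      U = evalR (geometric k) y
      K : R
      K = evalR [x-1]³ y
      X : R
      X = evalR xm1 y
      H : R
      H = evalR h y
      Qv : R
      Qv = evalR Q y
      Ev : R
      Ev = evalR E y
      PE : Pv ⊗ Ev ≡ K ⊗ X
      PE = trans (sym (evalR-*ₚ P E y)) (trans PE≡[x-1]⁴ (evalR-*ₚ [x-1]³ xm1 y))
      PQ : Pv ⊗ Qv ≡ zeroR
      PQ = trans (sym (evalR-*ₚ P Q y)) PQ≡0
      G-atoms : G ≡ oneR ⊕ K ⊗ H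
      G-atoms = trans (evalR-+ₚ oneₚ ([x-1]³ *ₚ h) y) (cong₂ _⊕_ (evalR-constant (+ 1) y) (evalR-*ₚ [x-1]³ h y))
      rest-atoms : rest ≡ (U ⊗ Ev) ⊗ H ⊕ Qv ⊗ constR D
      rest-atoms = trans (evalR-+ₚ ((geometric k *ₚ E) *ₚ h) _ y)
        (cong₂ _⊕_ (trans (evalR-*ₚ (geometric k *ₚ E) h y) (cong (_⊗ H) (evalR-*ₚ (geometric k) E y)))
                   (trans (evalR-*ₚ Q (D ∷ []) y) (cong (Qv ⊗_) (evalR-constant D y))))

  prodConj-candidate-at-roots : ∀ {L} → VanishesAt P L →
    prodConj L (candidate P Q E k D h) ≡ prodConj L (oneMinusXᵏ k) ⊗ prodConj L (G₃ h)
  prodConj-candidate-at-roots {L} roots =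
    trans (prodOver-cong (All.map (λ {ℓ} → candidate-at-root (powX ℓ)) roots))
          (prodOver-⊗ (λ ℓ → evalR (oneMinusXᵏ k) (powX ℓ)) (λ ℓ → evalR (G₃ h) (powX ℓ)) L)

  prodConj-candidate-off-roots : ∀ {L} → AgreeAt (P *ₚ E) [x-1]⁴ L → VanishesAt (P *ₚ Q) L →
    prodConj L (candidate P Q E k D h) ≡ prodConj L (oneMinusXᵏ k)
  prodConj-candidate-off-roots PE PQ = prodOver-cong (All.zipWith (λ {ℓ} (e , z) → candidate-off-root (powX ℓ) e z) (PE , PQ))

evalℤ-+ₚ : ∀ p q a → evalℤ (p +ₚ q) a ≡ evalℤ p a + evalℤ q a
evalℤ-+ₚ [] q a = sym (ℤP.+-identityˡ _)
evalℤ-+ₚ (c ∷ p) [] a = sym (ℤP.+-identityʳ _)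
evalℤ-+ₚ (c ∷ p) (d ∷ q) a = trans (cong (λ t → c + d + a * t) (evalℤ-+ₚ p q a)) (regroup c d a _ _)
  where
  regroup : ∀ c d a s t → c + d + a * (s + t) ≡ (c + a * s) + (d + a * t)
  regroup = solve-∀

evalℤ-scaleₚ : ∀ c p a → evalℤ (scaleₚ c p) a ≡ c * evalℤ p a
evalℤ-scaleₚ c [] a = sym (ℤP.*-zeroʳ c)
evalℤ-scaleₚ c (d ∷ p) a = trans (cong (λ t → c * d + a * t) (evalℤ-scaleₚ c p a)) (regroup c d a _)
  where
  regroup : ∀ c d a s → c * d + a * (c * s) ≡ c * (d + a * s)
  regroup = solve-∀

evalℤ-*ₚ : ∀ p q a → evalℤ (p *ₚ q) a ≡ evalℤ p a * evalℤ q a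
evalℤ-*ₚ [] q a = sym (ℤP.*-zeroˡ (evalℤ q a))
evalℤ-*ₚ (c ∷ p) q a = begin
  evalℤ (scaleₚ c q +ₚ (+ 0 ∷ (p *ₚ q))) a            ≡⟨ evalℤ-+ₚ (scaleₚ c q) _ a ⟩
  evalℤ (scaleₚ c q) a + (+ 0 + a * evalℤ (p *ₚ q) a) ≡⟨ cong₂ (λ s t → s + (+ 0 + a * t)) (evalℤ-scaleₚ c q a) (evalℤ-*ₚ p q a) ⟩
  c * evalℤ q a + (+ 0 + a * (evalℤ p a * evalℤ q a)) ≡⟨ regroup c a (evalℤ p a) (evalℤ q a) ⟩
  (c + a * evalℤ p a) * evalℤ q a                     ∎
  where
  regroup : ∀ c a s t → c * t + (+ 0 + a * (s * t)) ≡ (c + a * s) * t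
  regroup = solve-∀

evalℤ-geometric : ∀ k → evalℤ (geometric k) (+ 1) ≡ + k
evalℤ-geometric zero = refl
evalℤ-geometric (suc k) = cong (λ t → + 1 + t) (trans (ℤP.*-identityˡ _) (evalℤ-geometric k))

evalℤ-oneMinusXᵏ : ∀ k → evalℤ (oneMinusXᵏ k) (+ 1) ≡ + 0
evalℤ-oneMinusXᵏ k = trans (evalℤ-*ₚ oneMinusX (geometric k) (+ 1)) (ℤP.*-zeroˡ (evalℤ (geometric k) (+ 1)))

candidate-at-1 : ∀ P Q E k D h → evalℤ P (+ 1) ≡ + 5 → evalℤ Q (+ 1) ≡ + 5 →
                 (+ k * evalℤ E (+ 1)) * evalℤ h (+ 1) + + 5 * D ≡ + 1 →
                 evalℤ (candidate P Q E k D h) (+ 1) ≡ + 5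
candidate-at-1 P Q E k D h P1 Q1 unit = begin
  evalℤ (candidate P Q E k D h) (+ 1)
    ≡⟨ evalℤ-+ₚ (oneMinusXᵏ k *ₚ G₃ h) _ (+ 1) ⟩
  evalℤ (oneMinusXᵏ k *ₚ G₃ h) (+ 1) + evalℤ (P *ₚ (((geometric k *ₚ E) *ₚ h) +ₚ (Q *ₚ (D ∷ [])))) (+ 1)
    ≡⟨ cong₂ _+_ (trans (evalℤ-*ₚ (oneMinusXᵏ k) (G₃ h) (+ 1)) (trans (cong (_* evalℤ (G₃ h) (+ 1)) (evalℤ-oneMinusXᵏ k)) (ℤP.*-zeroˡ (evalℤ (G₃ h) (+ 1)))))
                 (trans (evalℤ-*ₚ P _ (+ 1)) (cong₂ _*_ P1 (evalℤ-+ₚ ((geometric k *ₚ E) *ₚ h) _ (+ 1)))) ⟩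
  + 0 + + 5 * (evalℤ ((geometric k *ₚ E) *ₚ h) (+ 1) + evalℤ (Q *ₚ (D ∷ [])) (+ 1))
    ≡⟨ cong (λ t → + 0 + + 5 * t) (cong₂ _+_
         (trans (evalℤ-*ₚ (geometric k *ₚ E) h (+ 1)) (cong (_* evalℤ h (+ 1)) (trans (evalℤ-*ₚ (geometric k) E (+ 1)) (cong (_* evalℤ E (+ 1)) (evalℤ-geometric k)))))
         (trans (evalℤ-*ₚ Q (D ∷ []) (+ 1)) (cong₂ _*_ Q1 (trans (cong (λ t → D + t) (ℤP.*-zeroʳ (+ 1))) (ℤP.+-identityʳ D))))) ⟩
  + 0 + + 5 * ((+ k * evalℤ E (+ 1)) * evalℤ h (+ 1) + + 5 * D)
    ≡⟨ cong (λ t → + 0 + + 5 * t) unit ⟩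
  + 5 ∎

Invertible-mod-5 : ℤ → Set
Invertible-mod-5 a = ∃₂ λ k D → k ∈ (1 ∷ 2 ∷ 3 ∷ 4 ∷ []) × + k * a + + 5 * D ≡ + 1

invertible-mod-5 : ∀ a → ¬ (+ 5 ∣ a) → Invertible-mod-5 a
invertible-mod-5 a 5∤a = by-residue (a %ℕ 5) (a /ℕ 5) (a≡a%ℕn+[a/ℕn]*n a 5) (n%ℕd<d a 5)
  where
  shift : ∀ k r d t → k * (r + t * + 5) + + 5 * (d - k * t) ≡ k * r + + 5 * d
  shift = solve-∀
  lift : ∀ r t k d → k ∈ (1 ∷ 2 ∷ 3 ∷ 4 ∷ []) → a ≡ + r + t * + 5 → + k * + r + + 5 * d ≡ + 1 → Invertible-mod-5 a
  lift r t k d k∈ a≡ kr+5d≡1 =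
    k , d - + k * t , k∈ , trans (cong (λ x → + k * x + + 5 * (d - + k * t)) a≡) (trans (shift (+ k) (+ r) d t) kr+5d≡1)
  by-residue : ∀ r t → a ≡ + r + t * + 5 → r ℕ.< 5 → Invertible-mod-5 a
  by-residue 0 t a≡5t _ = ⊥-elim (5∤a (subst (5 ℕD.∣_) (sym ∣a∣≡∣t∣*5) (ℕD.n∣m*n ∣ t ∣)))
    where
    ∣a∣≡∣t∣*5 : ∣ a ∣ ≡ ∣ t ∣ ℕ.* 5
    ∣a∣≡∣t∣*5 = trans (cong ∣_∣ (trans a≡5t (ℤP.+-identityˡ (t * + 5)))) (ℤP.abs-* t (+ 5))
  by-residue 1 t a≡ _ = lift 1 t 1 (+ 0) (here refl) a≡ refl
  by-residue 2 t a≡ _ = lift 2 t 3 (- (+ 1)) (there (there (here refl))) a≡ refl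
  by-residue 3 t a≡ _ = lift 3 t 2 (- (+ 1)) (there (here refl)) a≡ refl
  by-residue 4 t a≡ _ = lift 4 t 4 (- (+ 3)) (there (there (there (here refl)))) a≡ refl
  by-residue (suc (suc (suc (suc (suc r))))) t _ (ℕ.s≤s (ℕ.s≤s (ℕ.s≤s (ℕ.s≤s (ℕ.s≤s ())))))

-- Agda's normaliser does not share the value of r in mulX r (it occurs under both
-- init and last), so evaluating residues through Residue is exponential; these
-- variants force every intermediate vector and are proved equal to the originals.
module StrictEvaluation {n : ℕ} (φ : Vec ℤ (suc n)) where
  open ResidueRing φ

  forceVec : ∀ {k} → Vec ℤ k → Vec ℤ k
  forceVec [] = []
  forceVec (x ∷ xs) = force x (λ x′ → force (forceVec xs) (λ xs′ → x′ ∷ xs′))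

  forceVec-≡ : ∀ {k} (v : Vec ℤ k) → forceVec v ≡ v
  forceVec-≡ [] = refl
  forceVec-≡ (x ∷ xs) = begin
    force x (λ x′ → force (forceVec xs) (λ xs′ → x′ ∷ xs′)) ≡⟨ force-≡ x _ ⟩
    force (forceVec xs) (λ xs′ → x ∷ xs′)                   ≡⟨ force-≡ (forceVec xs) _ ⟩
    x ∷ forceVec xs                                         ≡⟨ cong (x ∷_) (forceVec-≡ xs) ⟩
    x ∷ xs                                                  ∎

  mulS : R → R → R
  mulS a b = Vec.foldr (λ _ → R) (λ c r → forceVec (c · a ⊕ mulX (forceVec r))) zeroR b

  mulS-≡ : ∀ a b → mulS a b ≡ a ⊗ b
  mulS-≡ a b = go b
    where
    go : ∀ {k} (b : Vec ℤ k) → Vec.foldr (λ _ → R) (λ c r → forceVec (c · a ⊕ mulX (forceVec r))) zeroR b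
                             ≡ Vec.foldr (λ _ → R) (λ c r → c · a ⊕ mulX r) zeroR b
    go [] = refl
    go (c ∷ b) = trans (forceVec-≡ _) (cong (λ r → c · a ⊕ mulX r) (trans (forceVec-≡ _) (go b)))

  powS : ℕ → R
  powS zero = oneR
  powS (suc ℓ) = forceVec (mulX (powS ℓ))

  powS-≡ : ∀ ℓ → powS ℓ ≡ powX ℓ
  powS-≡ zero = refl
  powS-≡ (suc ℓ) = trans (forceVec-≡ _) (cong mulX (powS-≡ ℓ))

  evalS : Poly → R → R
  evalS p y = L.foldr (λ c r → forceVec (constR c ⊕ mulS y r)) zeroR p

  evalS-≡ : ∀ p y → evalS p y ≡ evalR p y
  evalS-≡ [] y = refl
  evalS-≡ (c ∷ p) y = trans (forceVec-≡ _) (cong (constR c ⊕_) (trans (mulS-≡ y (evalS p y)) (cong (y ⊗_) (evalS-≡ p y))))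

  prodS : List ℕ → Poly → R
  prodS L G = L.foldr (λ ℓ r → mulS (evalS G (powS ℓ)) r) oneR L

  prodS-≡ : ∀ L G → prodS L G ≡ prodConj L G
  prodS-≡ [] G = refl
  prodS-≡ (ℓ ∷ L) G = trans (mulS-≡ (evalS G (powS ℓ)) (prodS L G)) (cong₂ _⊗_ (trans (evalS-≡ G (powS ℓ)) (cong (evalR G) (powS-≡ ℓ))) (prodS-≡ L G))

  agreeAt : (p q : Poly) (L : List ℕ) → {True (all? (λ ℓ → ≡-dec ℤP._≟_ (evalS p (powS ℓ)) (evalS q (powS ℓ))) L)} →
            AgreeAt p q L
  agreeAt p q L {agree} = All.map (λ {ℓ} e → trans (sym (eval-≡ p ℓ)) (trans e (eval-≡ q ℓ))) (toWitness agree)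
    where
    eval-≡ : ∀ p ℓ → evalS p (powS ℓ) ≡ evalR p (powX ℓ)
    eval-≡ p ℓ = trans (evalS-≡ p (powS ℓ)) (cong (evalR p) (powS-≡ ℓ))

  prodConj-by-evaluation : ∀ L G c → prodS L G ≡ constR c → prodConj L G ≡ constR c
  prodConj-by-evaluation L G c e = trans (sym (prodS-≡ L G)) e

module R₅ = ResidueRing Φ₅-low
module R₂₅ = ResidueRing Φ₂₅-low
module S₅ = StrictEvaluation Φ₅-low
module S₂₅ = StrictEvaluation Φ₂₅-low

Φ₅ : Poly
Φ₅ = toList Φ₅-low L.∷ʳ + 1

Φ₂₅ : Poly
Φ₂₅ = toList Φ₂₅-low L.∷ʳ + 1

-- Φ₅·E₂₅ ≡ (x - 1)⁴ modulo Φ₂₅, and Φ₂₅·E₅ ≡ (x - 1)⁴ modulo Φ₅ (where Φ₂₅ ≡ 5);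
-- both congruences are checked below by evaluation at the relevant roots.
E₂₅ : Poly
E₂₅ = + 1 ∷ - (+ 4) ∷ + 8 ∷ - (+ 8) ∷ + 4 ∷ + 0 ∷ - (+ 3) ∷ + 6 ∷ - (+ 6) ∷ + 3 ∷ + 0 ∷ - (+ 2) ∷ + 4 ∷ - (+ 4) ∷ + 2 ∷ + 0 ∷ - (+ 1) ∷ + 2 ∷ - (+ 2) ∷ + 1 ∷ []

E₅ : Poly
E₅ = + 0 ∷ - (+ 1) ∷ + 1 ∷ - (+ 1) ∷ []

-- Opaque, so that the type checker never unfolds a product of residues over these
-- lists when comparing terms; _*R_ likewise unfolds along its right factor, which
-- is why constants are kept as left factors below.
opaque
  units₅ : List ℕ
  units₅ = 1 ∷ 2 ∷ 3 ∷ 4 ∷ []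

  units₂₅ : List ℕ
  units₂₅ = 1 ∷ 2 ∷ 3 ∷ 4 ∷ 6 ∷ 7 ∷ 8 ∷ 9 ∷ 11 ∷ 12 ∷ 13 ∷ 14 ∷ 16 ∷ 17 ∷ 18 ∷ 19 ∷ 21 ∷ 22 ∷ 23 ∷ 24 ∷ []

  multiplesOf5 : List ℕ
  multiplesOf5 = 5 ∷ 10 ∷ 15 ∷ 20 ∷ []

NormsOf1-xᵏ : ℕ → Set
NormsOf1-xᵏ k = R₅.prodConj units₅ (oneMinusXᵏ k) ≡ R₅.constR (+ 5)
              × R₂₅.prodConj units₂₅ (oneMinusXᵏ k) ≡ R₂₅.constR (+ 5)
              × R₂₅.prodConj multiplesOf5 (oneMinusXᵏ k) ≡ R₂₅.constR (+ 5)

opaque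
  unfolding units₅ units₂₅ multiplesOf5

  N₁-as-prodConj : ∀ G → N₁ G ≡ head (R₅.prodConj units₅ G)
  N₁-as-prodConj G = refl

  N₂-as-prodConj : ∀ G → N₂ G ≡ head (R₂₅.prodConj units₂₅ G)
  N₂-as-prodConj G = refl

  M₂₅-split : ∀ F → M₂₅ F ≡ head (R₂₅.constR (evalℤ F (+ 1)) R₂₅.⊗ R₂₅.prodConj multiplesOf5 F R₂₅.⊗ R₂₅.prodConj units₂₅ F)
  M₂₅-split F = cong head (cong₂ R₂₅._⊗_ (R₂₅.evalR-constR F (+ 1)) (R₂₅.prodOver-partition (5 ∣?_) (λ ℓ → R₂₅.evalR F (R₂₅.powX ℓ)) (L.applyUpTo suc 24)))

  multiplesOf5-as-map : L.map (5 ℕ.*_) units₅ ≡ multiplesOf5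
  multiplesOf5-as-map = refl

  norms-by-evaluation : ∀ k → S₅.prodS units₅ (oneMinusXᵏ k) ≡ R₅.constR (+ 5) →
    S₂₅.prodS units₂₅ (oneMinusXᵏ k) ≡ R₂₅.constR (+ 5) → S₂₅.prodS multiplesOf5 (oneMinusXᵏ k) ≡ R₂₅.constR (+ 5) →
    NormsOf1-xᵏ k
  norms-by-evaluation k e₅ e₂₅ e′₂₅ =
      S₅.prodConj-by-evaluation units₅ (oneMinusXᵏ k) (+ 5) e₅
    , S₂₅.prodConj-by-evaluation units₂₅ (oneMinusXᵏ k) (+ 5) e₂₅
    , S₂₅.prodConj-by-evaluation multiplesOf5 (oneMinusXᵏ k) (+ 5) e′₂₅

  norms : All NormsOf1-xᵏ (1 ∷ 2 ∷ 3 ∷ 4 ∷ [])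
  norms = norms-by-evaluation 1 refl refl refl ∷ norms-by-evaluation 2 refl refl refl
        ∷ norms-by-evaluation 3 refl refl refl ∷ norms-by-evaluation 4 refl refl refl ∷ []

  Φ₅-vanishes-units₅ : R₅.VanishesAt Φ₅ units₅
  Φ₅-vanishes-units₅ = S₅.agreeAt Φ₅ [] units₅

  Φ₅-vanishes-multiplesOf5 : R₂₅.VanishesAt Φ₅ multiplesOf5
  Φ₅-vanishes-multiplesOf5 = S₂₅.agreeAt Φ₅ [] multiplesOf5

  Φ₅E₂₅≡[x-1]⁴-units₂₅ : R₂₅.AgreeAt (Φ₅ *ₚ E₂₅) [x-1]⁴ units₂₅
  Φ₅E₂₅≡[x-1]⁴-units₂₅ = S₂₅.agreeAt (Φ₅ *ₚ E₂₅) [x-1]⁴ units₂₅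

  Φ₅Φ₂₅-vanishes-units₂₅ : R₂₅.VanishesAt (Φ₅ *ₚ Φ₂₅) units₂₅
  Φ₅Φ₂₅-vanishes-units₂₅ = S₂₅.agreeAt (Φ₅ *ₚ Φ₂₅) [] units₂₅

  Φ₂₅-vanishes-units₂₅ : R₂₅.VanishesAt Φ₂₅ units₂₅
  Φ₂₅-vanishes-units₂₅ = S₂₅.agreeAt Φ₂₅ [] units₂₅

  Φ₂₅E₅≡[x-1]⁴-units₅ : R₅.AgreeAt (Φ₂₅ *ₚ E₅) [x-1]⁴ units₅
  Φ₂₅E₅≡[x-1]⁴-units₅ = S₅.agreeAt (Φ₂₅ *ₚ E₅) [x-1]⁴ units₅

  Φ₂₅Φ₅-vanishes-units₅ : R₅.VanishesAt (Φ₂₅ *ₚ Φ₅) units₅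
  Φ₂₅Φ₅-vanishes-units₅ = S₅.agreeAt (Φ₂₅ *ₚ Φ₅) [] units₅

  Φ₂₅E₅≡[x-1]⁴-multiplesOf5 : R₂₅.AgreeAt (Φ₂₅ *ₚ E₅) [x-1]⁴ multiplesOf5
  Φ₂₅E₅≡[x-1]⁴-multiplesOf5 = S₂₅.agreeAt (Φ₂₅ *ₚ E₅) [x-1]⁴ multiplesOf5

  Φ₂₅Φ₅-vanishes-multiplesOf5 : R₂₅.VanishesAt (Φ₂₅ *ₚ Φ₅) multiplesOf5
  Φ₂₅Φ₅-vanishes-multiplesOf5 = S₂₅.agreeAt (Φ₂₅ *ₚ Φ₅) [] multiplesOf5

module ψ = Substitution Φ₅-low Φ₂₅-low (R₂₅.powX 5) (All.head (S₂₅.agreeAt Φ₅ [] (5 ∷ [])))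

x⁵-powers-constant-term : ∀ i → i ℕ.< 3 → head (R₂₅.powX 5 R₂₅.^R suc i) ≡ + 0
x⁵-powers-constant-term i i<3 = trans (cong head (R₂₅.powX-^R 5 (suc i))) (by-evaluation i i<3)
  where
  by-evaluation : ∀ i → i ℕ.< 3 → head (R₂₅.powX (5 ℕ.* suc i)) ≡ + 0
  by-evaluation 0 _ = trans (cong head (sym (S₂₅.powS-≡ (5 ℕ.* 1)))) refl
  by-evaluation 1 _ = trans (cong head (sym (S₂₅.powS-≡ (5 ℕ.* 2)))) refl
  by-evaluation 2 _ = trans (cong head (sym (S₂₅.powS-≡ (5 ℕ.* 3)))) refl
  by-evaluation (suc (suc (suc _))) (ℕ.s≤s (ℕ.s≤s (ℕ.s≤s ())))

prodConj-map-5* : ∀ L G → R₂₅.prodConj (L.map (5 ℕ.*_) L) G ≡ ψ.ψ (R₅.prodConj L G)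
prodConj-map-5* L G = trans (R₂₅.prodConj-map-* 5 L G) (sym (ψ.ψ-prodConj L G))

head-prodConj-multiplesOf5 : ∀ G → head (R₂₅.prodConj multiplesOf5 G) ≡ N₁ G
head-prodConj-multiplesOf5 G = begin
  head (R₂₅.prodConj multiplesOf5 G)              ≡⟨ cong (λ M → head (R₂₅.prodConj M G)) multiplesOf5-as-map ⟨
  head (R₂₅.prodConj (L.map (5 ℕ.*_) units₅) G)   ≡⟨ cong head (prodConj-map-5* units₅ G) ⟩
  head (ψ.ψ (R₅.prodConj units₅ G))               ≡⟨ ψ.head-ψ x⁵-powers-constant-term (R₅.prodConj units₅ G) ⟩
  head (R₅.prodConj units₅ G)                     ≡⟨ N₁-as-prodConj G ⟨
  N₁ G                                            ∎

5*5*5 : ∀ t → + 5 * (+ 5 * (+ 5 * t)) ≡ + 125 * t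
5*5*5 = solve-∀

Realisation₁ : ℤ → Set
Realisation₁ m = Σ Poly λ F → M₂₅ F ≡ + 125 * m × evalℤ F (+ 1) ≡ + 5 × N₂ F ≡ + 5 × N₁ F ≡ + 5 * m

Realisation₂ : ℤ → Set
Realisation₂ m = Σ Poly λ F → M₂₅ F ≡ + 125 * m × evalℤ F (+ 1) ≡ + 5 × N₁ F ≡ + 5 × N₂ F ≡ + 5 * m

module FromN₁ (h : Poly) (k : ℕ) (D : ℤ) (norms : NormsOf1-xᵏ k) (unit : + k * evalℤ h (+ 1) + + 5 * D ≡ + 1) where
  F : Poly
  F = candidate Φ₅ Φ₂₅ E₂₅ k D h

  private
    module C₅ = CandidateValues Φ₅-low Φ₅ Φ₂₅ E₂₅ k D h
    module C₂₅ = CandidateValues Φ₂₅-low Φ₅ Φ₂₅ E₂₅ k D h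
    open R₂₅ using (_⊗_; constR; prodConj)
    norm₅ : R₅.prodConj units₅ (oneMinusXᵏ k) ≡ R₅.constR (+ 5)
    norm₅ = proj₁ norms
    norm₂₅ : prodConj units₂₅ (oneMinusXᵏ k) ≡ constR (+ 5)
    norm₂₅ = proj₁ (proj₂ norms)
    norm′₂₅ : prodConj multiplesOf5 (oneMinusXᵏ k) ≡ constR (+ 5)
    norm′₂₅ = proj₂ (proj₂ norms)

  F-at-1 : evalℤ F (+ 1) ≡ + 5
  F-at-1 = candidate-at-1 Φ₅ Φ₂₅ E₂₅ k D h refl refl (trans (cong (λ t → t * evalℤ h (+ 1) + + 5 * D) (ℤP.*-identityʳ (+ k))) unit)

  N₁-F : N₁ F ≡ + 5 * N₁ (G₃ h)
  N₁-F = begin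
    N₁ F
      ≡⟨ N₁-as-prodConj F ⟩
    head (R₅.prodConj units₅ F)
      ≡⟨ cong head (C₅.prodConj-candidate-at-roots Φ₅-vanishes-units₅) ⟩
    head (R₅.prodConj units₅ (oneMinusXᵏ k) R₅.⊗ R₅.prodConj units₅ (G₃ h))
      ≡⟨ cong (λ t → head (t R₅.⊗ R₅.prodConj units₅ (G₃ h))) norm₅ ⟩
    head (R₅.constR (+ 5) R₅.⊗ R₅.prodConj units₅ (G₃ h))
      ≡⟨ R₅.head-constR-⊗ (+ 5) (R₅.prodConj units₅ (G₃ h)) ⟩
    + 5 * head (R₅.prodConj units₅ (G₃ h))
      ≡⟨ cong (+ 5 *_) (N₁-as-prodConj (G₃ h)) ⟨
    + 5 * N₁ (G₃ h) ∎

  units₂₅-off-roots : prodConj units₂₅ F ≡ constR (+ 5)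
  units₂₅-off-roots = trans (C₂₅.prodConj-candidate-off-roots Φ₅E₂₅≡[x-1]⁴-units₂₅ Φ₅Φ₂₅-vanishes-units₂₅) norm₂₅

  N₂-F : N₂ F ≡ + 5
  N₂-F = trans (N₂-as-prodConj F) (cong head units₂₅-off-roots)

  M₂₅-F : M₂₅ F ≡ + 125 * N₁ (G₃ h)
  M₂₅-F = begin
    M₂₅ F
      ≡⟨ M₂₅-split F ⟩
    head (constR (evalℤ F (+ 1)) ⊗ prodConj multiplesOf5 F ⊗ prodConj units₂₅ F)
      ≡⟨ cong (λ t → head (constR (evalℤ F (+ 1)) ⊗ t)) (R₂₅.⊗-comm (prodConj multiplesOf5 F) (prodConj units₂₅ F)) ⟩
    head (constR (evalℤ F (+ 1)) ⊗ prodConj units₂₅ F ⊗ prodConj multiplesOf5 F)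
      ≡⟨ cong (λ s → head (constR s ⊗ prodConj units₂₅ F ⊗ prodConj multiplesOf5 F)) F-at-1 ⟩
    head (constR (+ 5) ⊗ prodConj units₂₅ F ⊗ prodConj multiplesOf5 F)
      ≡⟨ cong (λ t → head (constR (+ 5) ⊗ t ⊗ prodConj multiplesOf5 F)) units₂₅-off-roots ⟩
    head (constR (+ 5) ⊗ constR (+ 5) ⊗ prodConj multiplesOf5 F)
      ≡⟨ cong (λ t → head (constR (+ 5) ⊗ constR (+ 5) ⊗ t)) (C₂₅.prodConj-candidate-at-roots Φ₅-vanishes-multiplesOf5) ⟩
    head (constR (+ 5) ⊗ constR (+ 5) ⊗ prodConj multiplesOf5 (oneMinusXᵏ k) ⊗ prodConj multiplesOf5 (G₃ h))
      ≡⟨ cong (λ t → head (constR (+ 5) ⊗ constR (+ 5) ⊗ t ⊗ prodConj multiplesOf5 (G₃ h))) norm′₂₅ ⟩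
    head (constR (+ 5) ⊗ constR (+ 5) ⊗ constR (+ 5) ⊗ prodConj multiplesOf5 (G₃ h))
      ≡⟨ R₂₅.head-constR-⊗³ (+ 5) (+ 5) (+ 5) (prodConj multiplesOf5 (G₃ h)) ⟩
    + 5 * (+ 5 * (+ 5 * head (prodConj multiplesOf5 (G₃ h))))
      ≡⟨ 5*5*5 (head (prodConj multiplesOf5 (G₃ h))) ⟩
    + 125 * head (prodConj multiplesOf5 (G₃ h))
      ≡⟨ cong (+ 125 *_) (head-prodConj-multiplesOf5 (G₃ h)) ⟩
    + 125 * N₁ (G₃ h) ∎

  construction : Realisation₁ (N₁ (G₃ h))
  construction = F , M₂₅-F , F-at-1 , N₂-F , N₁-F

module FromN₂ (h : Poly) (k : ℕ) (D : ℤ) (norms : NormsOf1-xᵏ k) (unit : + k * - evalℤ h (+ 1) + + 5 * D ≡ + 1) where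
  F : Poly
  F = candidate Φ₂₅ Φ₅ E₅ k D h

  private
    module C₅ = CandidateValues Φ₅-low Φ₂₅ Φ₅ E₅ k D h
    module C₂₅ = CandidateValues Φ₂₅-low Φ₂₅ Φ₅ E₅ k D h
    open R₂₅ using (_⊗_; constR; prodConj)
    norm₅ : R₅.prodConj units₅ (oneMinusXᵏ k) ≡ R₅.constR (+ 5)
    norm₅ = proj₁ norms
    norm₂₅ : prodConj units₂₅ (oneMinusXᵏ k) ≡ constR (+ 5)
    norm₂₅ = proj₁ (proj₂ norms)
    norm′₂₅ : prodConj multiplesOf5 (oneMinusXᵏ k) ≡ constR (+ 5)
    norm′₂₅ = proj₂ (proj₂ norms)
    sign : ∀ k h → k * - h ≡ (k * - (+ 1)) * h
    sign = solve-∀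

  F-at-1 : evalℤ F (+ 1) ≡ + 5
  F-at-1 = candidate-at-1 Φ₂₅ Φ₅ E₅ k D h refl refl (trans (cong (λ t → t + + 5 * D) (sym (sign (+ k) (evalℤ h (+ 1))))) unit)

  N₁-F : N₁ F ≡ + 5
  N₁-F = trans (N₁-as-prodConj F) (cong head (trans (C₅.prodConj-candidate-off-roots Φ₂₅E₅≡[x-1]⁴-units₅ Φ₂₅Φ₅-vanishes-units₅) norm₅))

  units₂₅-at-roots : prodConj units₂₅ F ≡ constR (+ 5) ⊗ prodConj units₂₅ (G₃ h)
  units₂₅-at-roots = trans (C₂₅.prodConj-candidate-at-roots Φ₂₅-vanishes-units₂₅) (cong (_⊗ prodConj units₂₅ (G₃ h)) norm₂₅)

  N₂-F : N₂ F ≡ + 5 * N₂ (G₃ h)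
  N₂-F = trans (N₂-as-prodConj F) (trans (cong head units₂₅-at-roots) (trans (R₂₅.head-constR-⊗ (+ 5) (prodConj units₂₅ (G₃ h))) (cong (+ 5 *_) (sym (N₂-as-prodConj (G₃ h))))))

  M₂₅-F : M₂₅ F ≡ + 125 * N₂ (G₃ h)
  M₂₅-F = begin
    M₂₅ F
      ≡⟨ M₂₅-split F ⟩
    head (constR (evalℤ F (+ 1)) ⊗ prodConj multiplesOf5 F ⊗ prodConj units₂₅ F)
      ≡⟨ cong (λ s → head (constR s ⊗ prodConj multiplesOf5 F ⊗ prodConj units₂₅ F)) F-at-1 ⟩
    head (constR (+ 5) ⊗ prodConj multiplesOf5 F ⊗ prodConj units₂₅ F)
      ≡⟨ cong (λ t → head (constR (+ 5) ⊗ t ⊗ prodConj units₂₅ F)) multiplesOf5-off-roots ⟩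
    head (constR (+ 5) ⊗ constR (+ 5) ⊗ prodConj units₂₅ F)
      ≡⟨ cong (λ t → head (constR (+ 5) ⊗ constR (+ 5) ⊗ t)) units₂₅-at-roots ⟩
    head (constR (+ 5) ⊗ constR (+ 5) ⊗ constR (+ 5) ⊗ prodConj units₂₅ (G₃ h))
      ≡⟨ R₂₅.head-constR-⊗³ (+ 5) (+ 5) (+ 5) (prodConj units₂₅ (G₃ h)) ⟩
    + 5 * (+ 5 * (+ 5 * head (prodConj units₂₅ (G₃ h))))
      ≡⟨ 5*5*5 (head (prodConj units₂₅ (G₃ h))) ⟩
    + 125 * head (prodConj units₂₅ (G₃ h))
      ≡⟨ cong (+ 125 *_) (N₂-as-prodConj (G₃ h)) ⟨
    + 125 * N₂ (G₃ h) ∎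
    where
    multiplesOf5-off-roots : prodConj multiplesOf5 F ≡ constR (+ 5)
    multiplesOf5-off-roots = trans (C₂₅.prodConj-candidate-off-roots Φ₂₅E₅≡[x-1]⁴-multiplesOf5 Φ₂₅Φ₅-vanishes-multiplesOf5) norm′₂₅

  construction : Realisation₂ (N₂ (G₃ h))
  construction = F , M₂₅-F , F-at-1 , N₁-F , N₂-F

realisation₁ : ∀ h → Invertible-mod-5 (evalℤ h (+ 1)) → Realisation₁ (N₁ (G₃ h))
realisation₁ h (k , D , k∈ , unit) = FromN₁.construction h k D (All.lookup norms k∈) unit

realisation₂ : ∀ h → Invertible-mod-5 (- evalℤ h (+ 1)) → Realisation₂ (N₂ (G₃ h))
realisation₂ h (k , D , k∈ , unit) = FromN₂.construction h k D (All.lookup norms k∈) unit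

5∤-neg : ∀ a → ¬ (+ 5 ∣ a) → ¬ (+ 5 ∣ - a)
5∤-neg a 5∤a 5∣-a = 5∤a (subst (5 ℕD.∣_) (ℤP.∣-i∣≡∣i∣ a) 5∣-a)

lemma3p4 : (m : ℤ) →
    ((Σ Poly λ h → (¬ (+ 5 ∣ evalℤ h (+ 1))) × m ≡ N₁ (G₃ h)) →
      Σ Poly λ F → M₂₅ F ≡ + 125 * m × evalℤ F (+ 1) ≡ + 5 × N₂ F ≡ + 5 × N₁ F ≡ + 5 * m)
    × ((Σ Poly λ h → (¬ (+ 5 ∣ evalℤ h (+ 1))) × m ≡ N₂ (G₃ h)) →
      Σ Poly λ F → M₂₅ F ≡ + 125 * m × evalℤ F (+ 1) ≡ + 5 × N₁ F ≡ + 5 × N₂ F ≡ + 5 * m)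
lemma3p4 m =
    (λ { (h , 5∤h , m≡N₁) → subst Realisation₁ (sym m≡N₁) (realisation₁ h (invertible-mod-5 (evalℤ h (+ 1)) 5∤h)) })
  , (λ { (h , 5∤h , m≡N₂) → subst Realisation₂ (sym m≡N₂) (realisation₂ h (invertible-mod-5 (- evalℤ h (+ 1)) (5∤-neg (evalℤ h (+ 1)) 5∤h))) })
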